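{- Let $S\subset\mathbb{F}_q^k$ be an arc, $t=q+k-1-|S|$, $G\subseteq S$ and $0\le n\le |G|-k+1$. Let $Q_G^{\uparrow n}$ be the matrix with rows indexed by $\binom{G}{k-1}$, columns indexed by ordered pairs $(U,A)$ with $U\in\binom{G}{n}$, $A\in\binom{G\setminus U}{k-2}$, and $(C,(U,A))$-entry $f_{A,S}(C\setminus A)$ if $A\subset C\subset G\setminus U$ and $0$ otherwise; let $I_G^{\uparrow n}$ have the same indexing and $(C,(U,A))$-entry $(-1)^{\tau(A,C)(t+1)}$ if $A\subset C\subset G\setminus U$ and $0$ otherwise. Then there exist invertible diagonal matrices $F_1,F_2$ such that $F_1Q_G^{\uparrow n}F_2=I_G^{\uparrow n}$.
   Context: $\mathbb{F}_q$ is a finite field of order $q$. An arc in $\mathbb{F}_q^k$ is an ordered family of at least $k$ vectors in which every subfamily of size $k$ is a basis; subsets inherit the order. $\binom{X}{m}$ is the set of $m$-subsets of $X$. Tangent function: for $A\in\binom{S}{k-2}$, let $H_A^1,\dots,H_A^m$ be all the $(k-1)$-dimensional subspaces of $\mathbb{F}_q^k$ meeting $S$ exactly in $A$, $\beta_A^i$ a linear functional with kernel $H_A^i$, and $f_{A,S}(x)=\prod_i\beta_A^i(x)$; $f_{A,S}(C\setminus A)$ means $f_{A,S}$ at the unique vector of $C\setminus A$. For ordered subsets $A\subset C$ with $|C|=|A|+1$, $\tau(A,C)$ is the minimum number of transpositions needed to reorder the sequence (elements of $A$ in order, then the element of $C\setminus A$) into the order of $C$. -}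

module Defs where

open import Level using (Level; suc; _⊔_)
open import Data.Nat as ℕ using (ℕ; zero; _≤_; _<?_)
open import Data.Nat.DivMod using (_%_)
open import Data.Integer as ℤ using (ℤ; +_)
open import Data.Fin using (Fin)
open import Data.Fin.Subset using (Subset; inside; outside; _∈_; _∉_; _⊆_; _∩_; _─_; ∁; ∣_∣)
open import Data.Fin.Subset.Properties using (_⊆?_)
open import Data.Vec using ([]; _∷_; tabulate)
open import Data.Maybe using (Maybe; just; nothing)
import Data.Maybe as Maybe
open import Data.List using (List; foldr; map)
open import Data.List.Relation.Unary.All using (All)
open import Data.List.Relation.Unary.Any using (Any)
open import Data.List.Relation.Unary.AllPairs using (AllPairs)
open import Data.Product using (Σ; ∃; _×_)
open import Data.Bool using (Bool; true; false; if_then_else_; _∧_)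
open import Relation.Nullary using (¬_; does)
open import Relation.Binary.PropositionalEquality using (_≡_)
open import Function using (_∘_)
open import Function.Definitions using (Injective)
open import Algebra.Bundles using (CommutativeRing)

record FiniteField (c ℓ : Level) (q : ℕ) : Set (suc (c ⊔ ℓ)) where
  field
    commRing : CommutativeRing c ℓ
  open CommutativeRing commRing public
  field
    1≉0     : ¬ (1# ≈ 0#)
    inverse : ∀ x → ¬ (x ≈ 0#) → ∃ λ y → x * y ≈ 1#
    enum      : Fin q → Carrier
    enum-inj  : ∀ i j → enum i ≈ enum j → i ≡ j
    enum-surj : ∀ x → ∃ λ i → enum i ≈ x

module _ {c ℓ : Level} {q : ℕ} (F : FiniteField c ℓ q) where
  open FiniteField F

  -- vectors of F_q^k and linear functionals on F_q^k (by coefficients)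
  Vector : ℕ → Set c
  Vector k = Fin k → Carrier

  Σ[_] : ∀ {m} → (Fin m → Carrier) → Carrier
  Σ[_] {zero}    f = 0#
  Σ[_] {ℕ.suc m} f = f Fin.zero + Σ[_] (f ∘ Fin.suc)
    where import Data.Fin as Fin

  prod : List Carrier → Carrier
  prod = foldr _*_ 1#

  ev : ∀ {k} → Vector k → Vector k → Carrier
  ev β x = Σ[ (λ j → β j * x j) ]

  LinIndep : ∀ {k m} → (Fin m → Vector k) → Set (c ⊔ ℓ)
  LinIndep {k} {m} v = ∀ (a : Fin m → Carrier) →
    (∀ j → Σ[ (λ i → a i * v i j) ] ≈ 0#) → ∀ i → a i ≈ 0#

  Spans : ∀ {k m} → (Fin m → Vector k) → Set (c ⊔ ℓ)
  Spans {k} {m} v = ∀ (x : Vector k) →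
    ∃ λ (a : Fin m → Carrier) → ∀ j → Σ[ (λ i → a i * v i j) ] ≈ x j

  IsBasis : ∀ {k m} → (Fin m → Vector k) → Set (c ⊔ ℓ)
  IsBasis v = LinIndep v × Spans v

  IsArc : ∀ {k s} → (Fin s → Vector k) → Set (c ⊔ ℓ)
  IsArc {k} {s} S = k ≤ s × (∀ (ι : Fin k → Fin s) → Injective _≡_ _≡_ ι → IsBasis (S ∘ ι))

  -- hyperplanes ((k-1)-dim subspaces) = kernels of nonzero functionals
  NonZeroFun : ∀ {k} → Vector k → Set ℓ
  NonZeroFun β = ¬ (∀ j → β j ≈ 0#)

  SameKernel : ∀ {k} → Vector k → Vector k → Set (c ⊔ ℓ)
  SameKernel β γ = ∀ x → (ev β x ≈ 0# → ev γ x ≈ 0#) × (ev γ x ≈ 0# → ev β x ≈ 0#)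

  MeetsExactly : ∀ {k s} → (Fin s → Vector k) → Subset s → Vector k → Set ℓ
  MeetsExactly S A β = ∀ i → (ev β (S i) ≈ 0# → i ∈ A) × (i ∈ A → ev β (S i) ≈ 0#)

  -- βs is a list of functionals β_A^1,…,β_A^m whose kernels are exactly
  -- (each once) the hyperplanes meeting S exactly in A
  IsTangentList : ∀ {k s} → (Fin s → Vector k) → Subset s → List (Vector k) → Set (c ⊔ ℓ)
  IsTangentList S A βs =
    All (λ β → NonZeroFun β × MeetsExactly S A β) βs
    × (∀ γ → NonZeroFun γ → MeetsExactly S A γ → Any (SameKernel γ) βs)
    × AllPairs (λ β γ → ¬ SameKernel β γ) βs

  tangent : ∀ {k} → List (Vector k) → Vector k → Carrier
  tangent βs x = prod (map (λ β → ev β x) βs)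

  signPow : ℤ → Carrier
  signPow e = if does (ℤ.∣ e ∣ % 2 ℕ.≟ 0) then 1# else - 1#

first : ∀ {n} → Subset n → Maybe (Fin n)
first [] = nothing
first (inside ∷ p) = just Fin.zero where import Data.Fin as Fin
first (outside ∷ p) = Maybe.map Fin.suc (first p) where import Data.Fin as Fin

-- τ(A, C) where c is the unique element of C \ A: the number of
-- transpositions needed to move c from the end of (A in order, c)
-- to its place in C = number of elements of A after c.
τ : ∀ {n} → Subset n → Fin n → ℕ
τ A c = ∣ A ∩ tabulate (λ i → does (Data.Fin.toℕ c <? Data.Fin.toℕ i)) ∣
  where import Data.Fin

module Matrices {c ℓ : Level} {q : ℕ} (F : FiniteField c ℓ q)
                {k s : ℕ} (S : Fin s → Vector F k)
                (tang : Subset s → List (Vector F k)) (G : Subset s) where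
  open FiniteField F

  -- t = q + k - 1 - |S|, so t + 1 = q + k - |S|
  t+1 : ℤ
  t+1 = + (q ℕ.+ k) ℤ.- + s

  Q : Subset s → Subset s → Subset s → Carrier
  Q C U A =
    if does (A ⊆? C) ∧ does (C ⊆? (G ─ U))
    then (Maybe.maybe (λ x → tangent F (tang A) (S x)) 0# (first (C ─ A)))
    else 0#

  I : Subset s → Subset s → Subset s → Carrier
  I C U A =
    if does (A ⊆? C) ∧ does (C ⊆? (G ─ U))
    then (Maybe.maybe (λ x → signPow F (+ (τ A x) ℤ.* t+1)) 0# (first (C ─ A)))
    else 0#

-- Write k = m + 2, let C range over the (k-1)-subsets and A over the (k-2)-subsets of S,
-- and N = |S| - (k - 1). Take
--   d₁ C = ∏_{w ∉ C} det(w, C),   d₂ (U, A) = (-1)^{mN} / K_A(y),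
--   K_A(y) = f_{A,S}(y) · ∏_{w ∉ A ∪ {y}} det(w, y, A)   for some y ∉ A.
-- K_A(y) does not depend on y (coordinate-free lemma of tangents): for y ≠ z the functionals
-- vanishing on A form the pencil x ↦ det(x, y, A) - r det(x, z, A); the parameters r of its
-- secants through a third point w and of its tangents enumerate the nonzero field elements
-- exactly once, so their product is -1 by Wilson's theorem, and this rearranges into
-- K_A(y) = K_A(z). Moving y to its place in C = A ∪ {y} turns det(w, y, A) into
-- (-1)^p det(w, C) with p + τ(A, C) = m, so (d₁ C) f_{A,S}(y) d₂ = (-1)^{τ N}; finally
-- t + 1 = (q + 1) - N and q + 1 is even unless 1 + 1 = 0, so this is (-1)^{τ (t+1)}.

module Submission where

open import Defs
open import Level using (Level; _⊔_)
open import Function using (_∘_)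
open import Function.Definitions using (Injective)
open import Data.Empty using (⊥-elim)
open import Data.Unit.Polymorphic using (⊤)
open import Data.Bool using (true; false; if_then_else_; _∧_)
open import Data.Nat as ℕ using (ℕ; zero; suc; _≤_; _∸_; s≤s; z≤n)
import Data.Nat.Properties as ℕP
open import Data.Nat.Solver using (module +-*-Solver)
open import Data.Nat.DivMod using (_%_; [m+n]%n≡m%n)
open import Data.Integer as ℤ using (ℤ; +_; -[1+_]; +0; +[1+_]; _⊖_)
import Data.Integer.Properties as ℤP
open import Data.Sign as Sign using (Sign)
open import Data.Fin as Fin using (Fin; zero; suc; punchIn; toℕ)
import Data.Fin.Properties as FinP
open import Data.Fin.Subset using (Subset; inside; outside; _∈_; _∉_; _⊆_; _∩_; _∪_; _─_; ∁; ⁅_⁆; ∣_∣)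
open import Data.Fin.Subset.Properties
  using (_∈?_; _⊆?_; drop-there; drop-∷-⊆; p⊆q⇒∣p∣≤∣q∣; ∪-identityʳ; ∪-assoc; ∪-comm; x∈⁅x⁆; x∈⁅y⁆⇒x≡y;
         x∈p∪q⁺; x∈p∪q⁻; x∈p⇒x∉∁p; x∈∁p⇒x∉p; x∉p⇒x∈∁p; ∣∁p∣≡n∸∣p∣)
open import Data.Vec as Vec using ([]; _∷_; here; there)
open import Data.Vec.Functional using (removeAt)
open import Data.Product using (∃; _×_; _,_; proj₁; proj₂)
open import Data.Sum using (_⊎_; inj₁; inj₂)
open import Data.Maybe as Maybe using (Maybe; just; nothing)
open import Data.List as List using (List; []; _∷_; _++_; [_]; map; length; filter; tabulate)
import Data.List.Properties as List
open import Data.List.Membership.Propositional using (find; lose) renaming (_∈_ to _∈ₗ_)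
open import Data.List.Membership.Propositional.Properties using (∈-∃++; ∈-lookup; ∈-tabulate⁺; ∈-map⁺; ∈-map⁻)
open import Data.List.Relation.Unary.All as All using (All; []; _∷_)
import Data.List.Relation.Unary.All.Properties as All
open import Data.List.Relation.Unary.All.Properties using (¬All⇒Any¬)
open import Data.List.Relation.Unary.Any as Any using (Any; here; there; any?)
import Data.List.Relation.Unary.Any.Properties as Any
open import Data.List.Relation.Unary.AllPairs as AllPairs using (AllPairs; []; _∷_)
import Data.List.Relation.Unary.AllPairs.Properties as AllPairs
open import Data.List.Relation.Binary.Pointwise as Pointwise using (Pointwise; []; _∷_)
open import Relation.Nullary using (¬_; Dec; yes; no; does)
open import Relation.Binary.Definitions using (Decidable)
open import Relation.Binary.PropositionalEquality as ≡ using (_≡_; _≢_; _≗_)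
open import Algebra.Bundles using (CommutativeRing)
open import Algebra.Solver.Ring.AlmostCommutativeRing using (fromCommutativeRing; _-Raw-AlmostCommutative⟶_)

-- Integer coefficients keep the solver's coefficient equality decidable in any commutative ring.
module IntegerRingSolver {c ℓ : Level} (R : CommutativeRing c ℓ) where
  open CommutativeRing R
  open import Algebra.Properties.Semiring.Mult.TCOptimised semiring
    using (×-homo-+; ×1-homo-*) renaming (_×_ to _·_)
  open import Algebra.Properties.Ring ring using (-1*x≈-x; -‿involutive)
  open import Algebra.Properties.AbelianGroup +-abelianGroup using (ε⁻¹≈ε; ⁻¹-∙-comm)
  open import Algebra.Properties.CommutativeSemigroup *-commutativeSemigroup
    using () renaming (interchange to *-interchange)
  open import Algebra.Properties.CommutativeSemigroup +-commutativeSemigroup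
    using () renaming (interchange to +-interchange)
  open import Relation.Binary.Reasoning.Setoid setoid

  private
    fromSign : Sign → Carrier
    fromSign (Sign.+) = 1#
    fromSign (Sign.-) = - 1#

    fromℤ : ℤ → Carrier
    fromℤ (+ n)      = n · 1#
    fromℤ (-[1+ n ]) = - (suc n · 1#)

    ⊖-homo : ∀ m n → fromℤ (m ⊖ n) ≈ m · 1# - n · 1#
    ⊖-homo m zero = begin
      fromℤ (m ⊖ 0)     ≡⟨ ≡.cong fromℤ (ℤP.⊖-≥ {m} z≤n) ⟩
      m · 1#            ≈⟨ +-identityʳ _ ⟨
      m · 1# + 0#       ≈⟨ +-congˡ ε⁻¹≈ε ⟨
      m · 1# - 0 · 1#   ∎
    ⊖-homo zero (suc n) = sym (+-identityˡ _)
    ⊖-homo (suc m) (suc n) = begin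
      fromℤ (suc m ⊖ suc n)                ≡⟨ ≡.cong fromℤ (ℤP.[1+m]⊖[1+n]≡m⊖n m n) ⟩
      fromℤ (m ⊖ n)                        ≈⟨ ⊖-homo m n ⟩
      m · 1# - n · 1#                      ≈⟨ +-identityˡ _ ⟨
      0# + (m · 1# - n · 1#)               ≈⟨ +-congʳ (-‿inverseʳ 1#) ⟨
      (1# - 1#) + (m · 1# - n · 1#)        ≈⟨ +-interchange _ _ _ _ ⟩
      (1# + m · 1#) + (- 1# - n · 1#)      ≈⟨ +-congˡ (⁻¹-∙-comm 1# (n · 1#)) ⟩
      (1# + m · 1#) - (1# + n · 1#)        ≈⟨ +-cong (×-homo-+ 1# 1 m) (-‿cong (×-homo-+ 1# 1 n)) ⟨
      suc m · 1# - suc n · 1#              ∎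

    +-homo : ∀ i j → fromℤ (i ℤ.+ j) ≈ fromℤ i + fromℤ j
    +-homo -[1+ m ] -[1+ n ] = begin
      - (suc (suc (m ℕ.+ n)) · 1#)        ≡⟨ ≡.cong (λ k → - (k · 1#)) (ℕP.+-suc (suc m) n) ⟨
      - ((suc m ℕ.+ suc n) · 1#)          ≈⟨ -‿cong (×-homo-+ 1# (suc m) (suc n)) ⟩
      - (suc m · 1# + suc n · 1#)         ≈⟨ ⁻¹-∙-comm _ _ ⟨
      - (suc m · 1#) + - (suc n · 1#)     ∎
    +-homo -[1+ m ] (+ n)    = trans (⊖-homo n (suc m)) (+-comm _ _)
    +-homo (+ m)    -[1+ n ] = ⊖-homo m (suc n)
    +-homo (+ m)    (+ n)    = ×-homo-+ 1# m n

    ◃-homo : ∀ s n → fromℤ (s ℤ.◃ n) ≈ fromSign s * n · 1#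
    ◃-homo s      zero    = sym (zeroʳ _)
    ◃-homo Sign.+ (suc n) = sym (*-identityˡ _)
    ◃-homo Sign.- (suc n) = sym (-1*x≈-x _)

    *-homoˢ : ∀ s t → fromSign (s Sign.* t) ≈ fromSign s * fromSign t
    *-homoˢ Sign.- Sign.- = sym (trans (-1*x≈-x _) (-‿involutive 1#))
    *-homoˢ Sign.- Sign.+ = sym (*-identityʳ _)
    *-homoˢ Sign.+ t      = sym (*-identityˡ _)

    sign-abs : ∀ i → fromℤ i ≈ fromSign (ℤ.sign i) * ℤ.∣ i ∣ · 1#
    sign-abs i = trans (reflexive (≡.cong fromℤ (≡.sym (ℤP.◃-inverse i)))) (◃-homo (ℤ.sign i) ℤ.∣ i ∣)

    *-homo : ∀ i j → fromℤ (i ℤ.* j) ≈ fromℤ i * fromℤ j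
    *-homo i j = begin
      fromℤ (i ℤ.* j)
        ≈⟨ ◃-homo (ℤ.sign i Sign.* ℤ.sign j) (ℤ.∣ i ∣ ℕ.* ℤ.∣ j ∣) ⟩
      fromSign (ℤ.sign i Sign.* ℤ.sign j) * (ℤ.∣ i ∣ ℕ.* ℤ.∣ j ∣) · 1#
        ≈⟨ *-cong (*-homoˢ (ℤ.sign i) (ℤ.sign j)) (×1-homo-* ℤ.∣ i ∣ ℤ.∣ j ∣) ⟩
      (fromSign (ℤ.sign i) * fromSign (ℤ.sign j)) * (ℤ.∣ i ∣ · 1# * ℤ.∣ j ∣ · 1#)
        ≈⟨ *-interchange _ _ _ _ ⟩
      (fromSign (ℤ.sign i) * ℤ.∣ i ∣ · 1#) * (fromSign (ℤ.sign j) * ℤ.∣ j ∣ · 1#)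
        ≈⟨ *-cong (sign-abs i) (sign-abs j) ⟨
      fromℤ i * fromℤ j ∎

    -‿homo : ∀ i → fromℤ (ℤ.- i) ≈ - fromℤ i
    -‿homo -[1+ n ] = sym (-‿involutive _)
    -‿homo +0       = sym ε⁻¹≈ε
    -‿homo +[1+ n ] = refl

    homomorphism : ℤ.+-*-rawRing -Raw-AlmostCommutative⟶ fromCommutativeRing R
    homomorphism = record
      { ⟦_⟧ = fromℤ ; +-homo = +-homo ; *-homo = *-homo ; -‿homo = -‿homo
      ; 0-homo = refl ; 1-homo = refl }

    ≡-weaklyDecidable : ∀ i j → Maybe (fromℤ i ≈ fromℤ j)
    ≡-weaklyDecidable i j with i ℤ.≟ j
    ... | yes ≡.refl = just refl
    ... | no _       = nothing

  open import Algebra.Solver.Ring ℤ.+-*-rawRing (fromCommutativeRing R) homomorphism ≡-weaklyDecidable public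

module MinusOnePowers {c ℓ : Level} (R : CommutativeRing c ℓ) where
  open CommutativeRing R
  open import Algebra.Properties.Semiring.Exp semiring using (_^_; ^-homo-*)
  open IntegerRingSolver R using (solve; _:=_; _:*_; :-_; con)

  -1^_ : ℕ → Carrier
  -1^ n = (- 1#) ^ n

  -1^-+ : ∀ m n → -1^ (m ℕ.+ n) ≈ -1^ m * -1^ n
  -1^-+ = ^-homo-* (- 1#)

  -1^-square : ∀ n → -1^ n * -1^ n ≈ 1#
  -1^-square zero    = *-identityˡ 1#
  -1^-square (suc n) = trans
    (solve 1 (λ a → (:- con (+ 1) :* a) :* (:- con (+ 1) :* a) := a :* a) refl (-1^ n))
    (-1^-square n)

  -1^-double : ∀ n → -1^ (n ℕ.+ n) ≈ 1#
  -1^-double n = trans (-1^-+ n n) (-1^-square n)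

module FieldProperties {c ℓ : Level} {q : ℕ} (F : FiniteField c ℓ q) where
  open FiniteField F public hiding (zero)
  open import Algebra.Properties.Ring ring public
    using (-‿distribˡ-*; -1*x≈-x; -‿involutive)
  open import Algebra.Properties.AbelianGroup +-abelianGroup public
    using (ε⁻¹≈ε; ⁻¹-∙-comm; inverseˡ-unique)
  open import Algebra.Properties.CommutativeSemigroup *-commutativeSemigroup public
    using () renaming (interchange to *-interchange)
  open import Algebra.Properties.Semiring.Exp semiring public
    using (_^_; ^-homo-*; ^-assocʳ)
  open import Relation.Binary.Reasoning.Setoid setoid public
  open IntegerRingSolver commRing public
    using (solve; _:=_; _:+_; _:*_; :-_; _:-_; con)
  open MinusOnePowers commRing public

  infix 4 _≟_
  _≟_ : Decidable _≈_
  x ≟ y with enum-surj x | enum-surj y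
  ... | i , eᵢ | j , eⱼ with i FinP.≟ j
  ... | yes ≡.refl = yes (trans (sym eᵢ) eⱼ)
  ... | no i≢j     = no λ x≈y → i≢j (enum-inj i j (trans eᵢ (trans x≈y (sym eⱼ))))

  -- junk value: 0# ⁻¹ = 0#
  infix 9 _⁻¹
  _⁻¹ : Carrier → Carrier
  x ⁻¹ with x ≟ 0#
  ... | yes _   = 0#
  ... | no x≉0 = proj₁ (inverse x x≉0)

  *-inverseʳ : ∀ {x} → x ≉ 0# → x * x ⁻¹ ≈ 1#
  *-inverseʳ {x} x≉0 with x ≟ 0#
  ... | yes x≈0  = ⊥-elim (x≉0 x≈0)
  ... | no x≉0′ = proj₂ (inverse x x≉0′)

  *-≉0 : ∀ {x y} → x ≉ 0# → y ≉ 0# → x * y ≉ 0#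
  *-≉0 {x} {y} x≉0 y≉0 xy≈0 = 1≉0 (begin
    1#                        ≈⟨ *-identityʳ 1# ⟨
    1# * 1#                   ≈⟨ *-cong (*-inverseʳ x≉0) (*-inverseʳ y≉0) ⟨
    (x * x ⁻¹) * (y * y ⁻¹)   ≈⟨ *-interchange x (x ⁻¹) y (y ⁻¹) ⟩
    (x * y) * (x ⁻¹ * y ⁻¹)   ≈⟨ *-congʳ xy≈0 ⟩
    0# * (x ⁻¹ * y ⁻¹)        ≈⟨ zeroˡ _ ⟩
    0#                        ∎)

  x*y≈0⇒x≈0 : ∀ {x y} → y ≉ 0# → x * y ≈ 0# → x ≈ 0#
  x*y≈0⇒x≈0 {x} y≉0 xy≈0 with x ≟ 0#
  ... | yes x≈0 = x≈0
  ... | no x≉0  = ⊥-elim (*-≉0 x≉0 y≉0 xy≈0)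

  ⁻¹-≉0 : ∀ {x} → x ≉ 0# → x ⁻¹ ≉ 0#
  ⁻¹-≉0 {x} x≉0 x⁻¹≈0 = 1≉0 (trans (sym (*-inverseʳ x≉0)) (trans (*-congˡ x⁻¹≈0) (zeroʳ x)))

  ⁻¹-unique : ∀ {x y} → x * y ≈ 1# → x ⁻¹ ≈ y
  ⁻¹-unique {x} {y} xy≈1 = begin
    x ⁻¹               ≈⟨ *-identityʳ _ ⟨
    x ⁻¹ * 1#          ≈⟨ *-congˡ xy≈1 ⟨
    x ⁻¹ * (x * y)     ≈⟨ *-assoc _ _ _ ⟨
    (x ⁻¹ * x) * y     ≈⟨ *-congʳ (trans (*-comm _ _) (*-inverseʳ x≉0)) ⟩
    1# * y             ≈⟨ *-identityˡ y ⟩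
    y                  ∎
    where
    x≉0 : x ≉ 0#
    x≉0 x≈0 = 1≉0 (trans (sym xy≈1) (trans (*-congʳ x≈0) (zeroˡ y)))

  x≈0⇒x⁻¹≈0 : ∀ {x} → x ≈ 0# → x ⁻¹ ≈ 0#
  x≈0⇒x⁻¹≈0 {x} x≈0 with x ≟ 0#
  ... | yes _   = refl
  ... | no x≉0 = ⊥-elim (x≉0 x≈0)

  ⁻¹-cong : ∀ {x y} → x ≈ y → x ⁻¹ ≈ y ⁻¹
  ⁻¹-cong {x} {y} x≈y = cases (x ≟ 0#)
    where
    cases : Dec (x ≈ 0#) → x ⁻¹ ≈ y ⁻¹
    cases (yes x≈0) = trans (x≈0⇒x⁻¹≈0 x≈0) (sym (x≈0⇒x⁻¹≈0 (trans (sym x≈y) x≈0)))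
    cases (no x≉0)  = sym (⁻¹-unique (trans (*-congʳ (sym x≈y)) (*-inverseʳ x≉0)))

  ⁻¹-involutive : ∀ x → x ⁻¹ ⁻¹ ≈ x
  ⁻¹-involutive x = cases (x ≟ 0#)
    where
    cases : Dec (x ≈ 0#) → x ⁻¹ ⁻¹ ≈ x
    cases (yes x≈0) = trans (x≈0⇒x⁻¹≈0 (x≈0⇒x⁻¹≈0 x≈0)) (sym x≈0)
    cases (no x≉0)  = ⁻¹-unique (trans (*-comm _ _) (*-inverseʳ x≉0))

  x*y⁻¹*y≈x : ∀ x {y} → y ≉ 0# → (x * y ⁻¹) * y ≈ x
  x*y⁻¹*y≈x x {y} y≉0 = begin
    (x * y ⁻¹) * y   ≈⟨ *-assoc x _ y ⟩
    x * (y ⁻¹ * y)   ≈⟨ *-congˡ (trans (*-comm _ y) (*-inverseʳ y≉0)) ⟩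
    x * 1#           ≈⟨ *-identityʳ x ⟩
    x                ∎

  x*y≈z⇒x≈z*y⁻¹ : ∀ {x y z} → y ≉ 0# → x * y ≈ z → x ≈ z * y ⁻¹
  x*y≈z⇒x≈z*y⁻¹ {x} {y} {z} y≉0 xy≈z = begin
    x                      ≈⟨ x*y⁻¹*y≈x x (⁻¹-≉0 y≉0) ⟨
    (x * y ⁻¹ ⁻¹) * y ⁻¹   ≈⟨ *-congʳ (*-congˡ (⁻¹-involutive y)) ⟩
    (x * y) * y ⁻¹         ≈⟨ *-congʳ xy≈z ⟩
    z * y ⁻¹               ∎

  prod-++ : ∀ xs ys → prod F (xs ++ ys) ≈ prod F xs * prod F ys
  prod-++ []       ys = sym (*-identityˡ _)
  prod-++ (x ∷ xs) ys = trans (*-congˡ (prod-++ xs ys)) (sym (*-assoc _ _ _))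

  prod-insert : ∀ xs x ys → prod F (xs ++ x ∷ ys) ≈ x * prod F (xs ++ ys)
  prod-insert []       x ys = refl
  prod-insert (z ∷ xs) x ys = begin
    z * prod F (xs ++ x ∷ ys)   ≈⟨ *-congˡ (prod-insert xs x ys) ⟩
    z * (x * prod F (xs ++ ys)) ≈⟨ *-assoc z x _ ⟨
    (z * x) * prod F (xs ++ ys) ≈⟨ *-congʳ (*-comm z x) ⟩
    (x * z) * prod F (xs ++ ys) ≈⟨ *-assoc x z _ ⟩
    x * (z * prod F (xs ++ ys)) ∎

  module _ {a} {A : Set a} where

    prod-map-* : ∀ (f g : A → Carrier) xs →
                 prod F (map (λ x → f x * g x) xs) ≈ prod F (map f xs) * prod F (map g xs)
    prod-map-* f g []       = sym (*-identityˡ _)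
    prod-map-* f g (x ∷ xs) =
      trans (*-congˡ (prod-map-* f g xs)) (*-interchange (f x) (g x) _ _)

    prod-map-cong : ∀ {f g : A → Carrier} {xs} → All (λ x → f x ≈ g x) xs →
                    prod F (map f xs) ≈ prod F (map g xs)
    prod-map-cong []       = refl
    prod-map-cong (e ∷ es) = *-cong e (prod-map-cong es)

    prod-map-const : ∀ x (xs : List A) → prod F (map (λ _ → x) xs) ≈ x ^ length xs
    prod-map-const x []       = refl
    prod-map-const x (_ ∷ xs) = *-congˡ (prod-map-const x xs)

  prod-≉0 : ∀ {xs} → All (_≉ 0#) xs → prod F xs ≉ 0#
  prod-≉0 []         = 1≉0
  prod-≉0 (x≉0 ∷ xs) = *-≉0 x≉0 (prod-≉0 xs)

  -1^-≉0 : ∀ n → -1^ n ≉ 0#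
  -1^-≉0 n e = 1≉0 (trans (sym (-1^-square n)) (trans (*-congʳ e) (zeroˡ _)))

module Determinant {c ℓ : Level} (R : CommutativeRing c ℓ) where
  open CommutativeRing R hiding (zero)
  open MinusOnePowers R
  open IntegerRingSolver R using (solve; _:=_; _:+_; _:*_; :-_; _:-_; con)
  open import Algebra.Properties.Semiring.Sum semiring
    using (sum; sum-cong-≋; ∑-distrib-+; *-distribˡ-sum; sum-replicate-zero)
  open import Algebra.Properties.AbelianGroup +-abelianGroup using (inverseˡ-unique; ε⁻¹≈ε)
  open import Algebra.Properties.Ring ring using (-‿distribˡ-*; -1*x≈-x)
  open import Data.Vec.Functional.Relation.Binary.Equality.Setoid setoid using (_≋_)
  open import Relation.Binary.Reasoning.Setoid setoid

  Row : ℕ → Set c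
  Row n = Fin n → Carrier

  dropColumn : ∀ {n} → Fin (suc n) → List (Row (suc n)) → List (Row n)
  dropColumn j = map (λ r → removeAt r j)

  columns : ∀ {p m} → (Fin p → Fin m) → List (Row m) → List (Row p)
  columns g = map (_∘ g)

  -- Laplace expansion along the first row; lists of the wrong length get 0#.
  det : ∀ n → List (Row n) → Carrier
  det zero    []       = 1#
  det zero    (_ ∷ _)  = 0#
  det (suc n) []       = 0#
  det (suc n) (x ∷ rs) = sum λ j → -1^ toℕ j * (x j * det n (dropColumn j rs))

  cofactor : ∀ {n} → List (Row (suc n)) → Row (suc n)
  cofactor {n} rs j = -1^ toℕ j * det n (dropColumn j rs)

  sum-≈0 : ∀ {n} {f : Row n} → (∀ i → f i ≈ 0#) → sum f ≈ 0#
  sum-≈0 {n} f≈0 = trans (sum-cong-≋ f≈0) (sum-replicate-zero n)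

  det-cong : ∀ n {rs rs′} → Pointwise _≋_ rs rs′ → det n rs ≈ det n rs′
  det-cong zero    []         = refl
  det-cong zero    (_ ∷ _)    = refl
  det-cong (suc n) []         = refl
  det-cong (suc n) (x≋ ∷ rs≋) = sum-cong-≋ λ j → *-congˡ { -1^ toℕ j} (*-cong (x≋ j)
    (det-cong n (Pointwise.map⁺ _ _ (Pointwise.map (λ r≋ → r≋ ∘ punchIn j) rs≋))))

  det-expand : ∀ {n} x rs → det (suc n) (x ∷ rs) ≈ sum λ j → cofactor rs j * x j
  det-expand x rs = sum-cong-≋ λ j →
    solve 3 (λ s a d → s :* (a :* d) := (s :* d) :* a) refl (-1^ toℕ j) (x j) (det _ (dropColumn j rs))

  det-expand-++ : ∀ {n} p pre mid → det (suc n) (p ∷ pre ++ mid) ≈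
    sum λ j → -1^ toℕ j * (p j * det n (dropColumn j pre ++ dropColumn j mid))
  det-expand-++ {n} p pre mid = sum-cong-≋ λ j →
    *-congˡ { -1^ toℕ j} (*-congˡ {p j} (reflexive (≡.cong (det n) (List.map-++ (λ r → removeAt r j) pre mid))))

  det-linear : ∀ n pre a (u v : Row n) post →
    det n (pre ++ (λ i → a * u i + v i) ∷ post) ≈ a * det n (pre ++ u ∷ post) + det n (pre ++ v ∷ post)
  det-linear zero [] a u v post = sym (trans (+-congʳ (zeroʳ a)) (+-identityʳ _))
  det-linear zero (_ ∷ _) a u v post = sym (trans (+-congʳ (zeroʳ a)) (+-identityʳ _))
  det-linear (suc n) [] a u v post = begin
    sum (λ j → s j * ((a * u j + v j) * M j))
      ≈⟨ sum-cong-≋ (λ j → solve 5 (λ s a u v m → s :* ((a :* u :+ v) :* m)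
                                 := a :* (s :* (u :* m)) :+ s :* (v :* m)) refl (s j) a (u j) (v j) (M j)) ⟩
    sum (λ j → a * (s j * (u j * M j)) + s j * (v j * M j))
      ≈⟨ ∑-distrib-+ (λ j → a * (s j * (u j * M j))) (λ j → s j * (v j * M j)) ⟩
    sum (λ j → a * (s j * (u j * M j))) + det (suc n) (v ∷ post)
      ≈⟨ +-congʳ (*-distribˡ-sum a (λ j → s j * (u j * M j))) ⟨
    a * det (suc n) (u ∷ post) + det (suc n) (v ∷ post) ∎
    where
    s = λ (j : Fin (suc n)) → -1^ toℕ j
    M = λ j → det n (dropColumn j post)
  det-linear (suc n) (p ∷ pre) a u v post = begin
    det (suc n) (p ∷ pre ++ w ∷ post)
      ≈⟨ det-expand-++ p pre (w ∷ post) ⟩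
    sum (λ j → s j * (p j * det n (dropColumn j pre ++ removeAt w j ∷ dropColumn j post)))
      ≈⟨ sum-cong-≋ (λ j → *-congˡ {s j} (*-congˡ {p j}
           (det-linear n (dropColumn j pre) a (removeAt u j) (removeAt v j) (dropColumn j post)))) ⟩
    sum (λ j → s j * (p j * (a * U j + V j)))
      ≈⟨ sum-cong-≋ (λ j → solve 5 (λ s a u v p → s :* (p :* (a :* u :+ v))
                                 := a :* (s :* (p :* u)) :+ s :* (p :* v)) refl (s j) a (U j) (V j) (p j)) ⟩
    sum (λ j → a * (s j * (p j * U j)) + s j * (p j * V j))
      ≈⟨ ∑-distrib-+ (λ j → a * (s j * (p j * U j))) (λ j → s j * (p j * V j)) ⟩
    sum (λ j → a * (s j * (p j * U j))) + sum (λ j → s j * (p j * V j))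
      ≈⟨ +-congʳ (*-distribˡ-sum a (λ j → s j * (p j * U j))) ⟨
    a * sum (λ j → s j * (p j * U j)) + sum (λ j → s j * (p j * V j))
      ≈⟨ +-cong (*-congˡ (det-expand-++ p pre (u ∷ post))) (det-expand-++ p pre (v ∷ post)) ⟨
    a * det (suc n) (p ∷ pre ++ u ∷ post) + det (suc n) (p ∷ pre ++ v ∷ post) ∎
    where
    w = λ i → a * u i + v i
    s = λ (j : Fin (suc n)) → -1^ toℕ j
    U = λ j → det n (dropColumn j pre ++ removeAt u j ∷ dropColumn j post)
    V = λ j → det n (dropColumn j pre ++ removeAt v j ∷ dropColumn j post)

  -- H j l, attached to the pair of columns {j, punchIn j l}, depends only on that pair
  PairSymmetric : ∀ m → (Fin (suc m) → Fin m → Carrier) → Set ℓ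
  PairSymmetric zero    H = ⊤
  PairSymmetric (suc m) H = (∀ l → H zero l ≈ H (suc l) zero)
                          × PairSymmetric m (λ j l → H (suc j) (suc l))

  PairSymmetric-resp : ∀ m {H H′} → (∀ j l → H j l ≈ H′ j l) → PairSymmetric m H → PairSymmetric m H′
  PairSymmetric-resp zero    H≈H′ _           = _
  PairSymmetric-resp (suc m) H≈H′ (H₀ , Hₛ) =
    (λ l → trans (sym (H≈H′ _ l)) (trans (H₀ l) (H≈H′ _ _))) ,
    PairSymmetric-resp m (λ j l → H≈H′ (suc j) (suc l)) Hₛ

  -- the two terms naming the same pair of columns carry opposite signs and cancel
  alternating-pair-sum≈0 : ∀ m (Y : Fin (suc m) → Fin (suc m) → Carrier) → (∀ a b → Y a b ≈ Y b a) →
    ∀ H → PairSymmetric m H →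
    sum (λ j → sum λ l → -1^ toℕ j * (-1^ toℕ l * (Y j (punchIn j l) * H j l))) ≈ 0#
  alternating-pair-sum≈0 zero    Y Y-sym H _ = +-identityˡ 0#
  alternating-pair-sum≈0 (suc m) Y Y-sym H (H₀ , Hₛ) = begin
    sum (T zero) + sum (λ j → T (suc j) zero + sum (T (suc j) ∘ suc))
      ≈⟨ +-congˡ (∑-distrib-+ (λ j → T (suc j) zero) (λ j → sum (T (suc j) ∘ suc))) ⟩
    sum (T zero) + (sum (λ j → T (suc j) zero) + sum (λ j → sum (T (suc j) ∘ suc)))
      ≈⟨ +-assoc _ _ _ ⟨
    (sum (T zero) + sum (λ j → T (suc j) zero)) + sum (λ j → sum (T (suc j) ∘ suc))
      ≈⟨ +-cong (trans (sym (∑-distrib-+ (T zero) (λ j → T (suc j) zero))) (sum-≈0 cancel)) inner ⟩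
    0# + 0#
      ≈⟨ +-identityˡ 0# ⟩
    0# ∎
    where
    T : Fin (suc (suc m)) → Fin (suc m) → Carrier
    T j l = -1^ toℕ j * (-1^ toℕ l * (Y j (punchIn j l) * H j l))
    cancel : ∀ l → T zero l + T (suc l) zero ≈ 0#
    cancel l = begin
      T zero l + T (suc l) zero
        ≈⟨ +-congˡ (*-congˡ { -1^ toℕ (suc l)} (*-congˡ {1#} (*-cong (Y-sym _ _) (sym (H₀ l))))) ⟩
      1# * (a * (y * h)) + (- 1# * a) * (1# * (y * h))
        ≈⟨ solve 3 (λ a y h → con (+ 1) :* (a :* (y :* h)) :+ (:- con (+ 1) :* a) :* (con (+ 1) :* (y :* h))
                              := con (+ 0)) refl a y h ⟩
      0# ∎
      where
      a = -1^ toℕ l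
      y = Y zero (suc l)
      h = H zero l
    inner : sum (λ j → sum (T (suc j) ∘ suc)) ≈ 0#
    inner = trans
      (sum-cong-≋ λ j → sum-cong-≋ λ l →
        solve 3 (λ a b w → (:- con (+ 1) :* a) :* ((:- con (+ 1) :* b) :* w) := a :* (b :* w))
          refl (-1^ toℕ j) (-1^ toℕ l) (Y (suc j) (suc (punchIn j l)) * H (suc j) (suc l)))
      (alternating-pair-sum≈0 m (λ a b → Y (suc a) (suc b)) (λ a b → Y-sym _ _) (λ j l → H (suc j) (suc l)) Hₛ)

  columns-pairSymmetric : ∀ p (Φ : (Fin p → Fin (suc (suc p))) → Carrier) →
    (∀ {g g′} → g ≗ g′ → Φ g ≈ Φ g′) →
    PairSymmetric (suc p) (λ j l → Φ (λ i → punchIn j (punchIn l i)))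
  columns-pairSymmetric zero    Φ Φ-cong = (λ l → refl) , _
  columns-pairSymmetric (suc p) Φ Φ-cong = (λ l → refl) ,
    PairSymmetric-resp (suc p)
      (λ j l → Φ-cong {Fin.lift 1 (λ i → punchIn j (punchIn l i))} {λ i → punchIn (suc j) (punchIn (suc l) i)}
                 λ { zero → ≡.refl ; (suc i) → ≡.refl })
      (columns-pairSymmetric p (Φ ∘ Fin.lift 1) λ g≗g′ → Φ-cong λ
        { zero → ≡.refl ; (suc i) → ≡.cong suc (g≗g′ i) })

  det-expand₂ : ∀ n x y rs → det (suc (suc n)) (x ∷ y ∷ rs) ≈
    sum λ j → sum λ l → -1^ toℕ j * (-1^ toℕ l * ((x j * y (punchIn j l)) *
                          det n (columns (λ i → punchIn j (punchIn l i)) rs)))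
  det-expand₂ n x y rs = sum-cong-≋ λ j → begin
    s j * (x j * sum (λ l → s l * (y (punchIn j l) * D j l)))
      ≈⟨ *-congˡ {s j} (*-distribˡ-sum (x j) (λ l → s l * (y (punchIn j l) * D j l))) ⟩
    s j * sum (λ l → x j * (s l * (y (punchIn j l) * D j l)))
      ≈⟨ *-distribˡ-sum (s j) (λ l → x j * (s l * (y (punchIn j l) * D j l))) ⟩
    sum (λ l → s j * (x j * (s l * (y (punchIn j l) * D j l))))
      ≈⟨ sum-cong-≋ (λ l → solve 5 (λ a xj b yv d → a :* (xj :* (b :* (yv :* d)))
                                   := a :* (b :* ((xj :* yv) :* d)))
                              refl (s j) (x j) (s l) (y (punchIn j l)) (D j l)) ⟩
    sum (λ l → s j * (s l * ((x j * y (punchIn j l)) * D j l)))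
      ≈⟨ sum-cong-≋ (λ l → reflexive (≡.cong (λ rs′ → s j * (s l * ((x j * y (punchIn j l)) * det n rs′)))
                                               (≡.sym (List.map-∘ {g = λ r → removeAt r l} {f = λ r → removeAt r j} rs)))) ⟩
    sum (λ l → s j * (s l * ((x j * y (punchIn j l)) * det n (columns (λ i → punchIn j (punchIn l i)) rs)))) ∎
    where
    s = λ {m} (j : Fin m) → -1^ toℕ j
    D = λ j l → det n (dropColumn l (dropColumn j rs))

  det-columns-cong : ∀ {p m} (rs : List (Row m)) {g g′ : Fin p → Fin m} → g ≗ g′ →
                     det p (columns g rs) ≈ det p (columns g′ rs)
  det-columns-cong {p} rs g≗g′ =
    det-cong p (Pointwise.map⁺ _ _ (Pointwise.refl (λ {r} i → reflexive (≡.cong r (g≗g′ i)))))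

  det₁-two-rows : ∀ x y rs → det 1 (x ∷ y ∷ rs) ≈ 0#
  det₁-two-rows x y rs = sum-≈0 λ j → trans (*-congˡ { -1^ toℕ j} (zeroʳ (x j))) (zeroʳ _)

  det-repeat₀ : ∀ n x rs → det n (x ∷ x ∷ rs) ≈ 0#
  det-repeat₀ zero          x rs = refl
  det-repeat₀ (suc zero)    x rs = det₁-two-rows x x rs
  det-repeat₀ (suc (suc n)) x rs = trans (det-expand₂ n x x rs)
    (alternating-pair-sum≈0 (suc n) (λ a b → x a * x b) (λ a b → *-comm _ _)
      (λ j l → det n (columns (λ i → punchIn j (punchIn l i)) rs))
      (columns-pairSymmetric n (λ g → det n (columns g rs)) (det-columns-cong rs)))

  det-swap₀ : ∀ n x y rs → det n (x ∷ y ∷ rs) + det n (y ∷ x ∷ rs) ≈ 0#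
  det-swap₀ zero          x y rs = +-identityʳ 0#
  det-swap₀ (suc zero)    x y rs = trans (+-cong (det₁-two-rows x y rs) (det₁-two-rows y x rs)) (+-identityʳ 0#)
  det-swap₀ (suc (suc n)) x y rs = begin
    det (suc (suc n)) (x ∷ y ∷ rs) + det (suc (suc n)) (y ∷ x ∷ rs)
      ≈⟨ +-cong (det-expand₂ n x y rs) (det-expand₂ n y x rs) ⟩
    sum (λ j → sum (T x y j)) + sum (λ j → sum (T y x j))
      ≈⟨ ∑-distrib-+ (λ j → sum (T x y j)) (λ j → sum (T y x j)) ⟨
    sum (λ j → sum (T x y j) + sum (T y x j))
      ≈⟨ sum-cong-≋ (λ j → ∑-distrib-+ (T x y j) (T y x j)) ⟨
    sum (λ j → sum (λ l → T x y j l + T y x j l))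
      ≈⟨ sum-cong-≋ (λ j → sum-cong-≋ λ l →
           solve 5 (λ a b u v h → a :* (b :* (u :* h)) :+ a :* (b :* (v :* h)) := a :* (b :* ((u :+ v) :* h)))
             refl (-1^ toℕ j) (-1^ toℕ l) (x j * y (punchIn j l)) (y j * x (punchIn j l)) (H j l)) ⟩
    sum (λ j → sum λ l → -1^ toℕ j * (-1^ toℕ l * (Y j (punchIn j l) * H j l)))
      ≈⟨ alternating-pair-sum≈0 (suc n) Y Y-sym H
           (columns-pairSymmetric n (λ g → det n (columns g rs)) (det-columns-cong rs)) ⟩
    0# ∎
    where
    H : Fin (suc (suc n)) → Fin (suc n) → Carrier
    H j l = det n (columns (λ i → punchIn j (punchIn l i)) rs)
    T : Row (suc (suc n)) → Row (suc (suc n)) → Fin (suc (suc n)) → Fin (suc n) → Carrier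
    T x y j l = -1^ toℕ j * (-1^ toℕ l * ((x j * y (punchIn j l)) * H j l))
    Y : Fin (suc (suc n)) → Fin (suc (suc n)) → Carrier
    Y a b = x a * y b + y a * x b
    Y-sym : ∀ a b → Y a b ≈ Y b a
    Y-sym a b = trans (+-comm _ _) (+-cong (*-comm _ _) (*-comm _ _))

  det-swap-sum : ∀ n pre x y post → det n (pre ++ x ∷ y ∷ post) + det n (pre ++ y ∷ x ∷ post) ≈ 0#
  det-swap-sum n       []        x y post = det-swap₀ n x y post
  det-swap-sum zero    (p ∷ pre) x y post = +-identityʳ 0#
  det-swap-sum (suc n) (p ∷ pre) x y post = begin
    det (suc n) (p ∷ pre ++ x ∷ y ∷ post) + det (suc n) (p ∷ pre ++ y ∷ x ∷ post)
      ≈⟨ +-cong (det-expand-++ p pre (x ∷ y ∷ post)) (det-expand-++ p pre (y ∷ x ∷ post)) ⟩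
    sum (λ j → s j * (p j * A j)) + sum (λ j → s j * (p j * B j))
      ≈⟨ ∑-distrib-+ (λ j → s j * (p j * A j)) (λ j → s j * (p j * B j)) ⟨
    sum (λ j → s j * (p j * A j) + s j * (p j * B j))
      ≈⟨ sum-≈0 (λ j → begin
           s j * (p j * A j) + s j * (p j * B j)
             ≈⟨ solve 4 (λ a b x y → a :* (b :* x) :+ a :* (b :* y) := a :* (b :* (x :+ y)))
                  refl (s j) (p j) (A j) (B j) ⟩
           s j * (p j * (A j + B j))
             ≈⟨ *-congˡ {s j} (*-congˡ {p j}
                  (det-swap-sum n (dropColumn j pre) (removeAt x j) (removeAt y j) (dropColumn j post))) ⟩
           s j * (p j * 0#)
             ≈⟨ trans (*-congˡ {s j} (zeroʳ (p j))) (zeroʳ (s j)) ⟩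
           0# ∎) ⟩
    0# ∎
    where
    s = λ (j : Fin (suc n)) → -1^ toℕ j
    A = λ j → det n (dropColumn j pre ++ removeAt x j ∷ removeAt y j ∷ dropColumn j post)
    B = λ j → det n (dropColumn j pre ++ removeAt y j ∷ removeAt x j ∷ dropColumn j post)

  det-swap : ∀ n pre x y post → det n (pre ++ x ∷ y ∷ post) ≈ - det n (pre ++ y ∷ x ∷ post)
  det-swap n pre x y post = inverseˡ-unique _ _ (det-swap-sum n pre x y post)

  det-adjacent : ∀ n pre x post → det n (pre ++ x ∷ x ∷ post) ≈ 0#
  det-adjacent n       []        x post = det-repeat₀ n x post
  det-adjacent zero    (p ∷ pre) x post = refl
  det-adjacent (suc n) (p ∷ pre) x post = trans (det-expand-++ p pre (x ∷ x ∷ post)) (sum-≈0 λ j →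
    trans (*-congˡ { -1^ toℕ j} (*-congˡ {p j}
            (det-adjacent n (dropColumn j pre) (removeAt x j) (dropColumn j post))))
          (trans (*-congˡ { -1^ toℕ j} (zeroʳ (p j))) (zeroʳ _)))

  ++-∷-assoc : ∀ {a} {A : Set a} (pre : List A) x rest → pre ++ x ∷ rest ≡ (pre ++ [ x ]) ++ rest
  ++-∷-assoc pre x rest = ≡.sym (List.++-assoc pre [ x ] rest)

  det-repeat : ∀ n pre x mid post → det n (pre ++ x ∷ mid ++ x ∷ post) ≈ 0#
  det-repeat n pre x []      post = det-adjacent n pre x post
  det-repeat n pre x (m ∷ mid) post = begin
    det n (pre ++ x ∷ m ∷ mid ++ x ∷ post)        ≈⟨ det-swap n pre x m _ ⟩
    - det n (pre ++ m ∷ x ∷ mid ++ x ∷ post)      ≡⟨ ≡.cong (λ rs → - det n rs) (++-∷-assoc pre m _) ⟩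
    - det n ((pre ++ [ m ]) ++ x ∷ mid ++ x ∷ post) ≈⟨ -‿cong (det-repeat n (pre ++ [ m ]) x mid post) ⟩
    - 0#                                           ≈⟨ ε⁻¹≈ε ⟩
    0# ∎

  det-move : ∀ n pre y mid post →
             det n (pre ++ y ∷ mid ++ post) ≈ -1^ length mid * det n (pre ++ mid ++ y ∷ post)
  det-move n pre y []        post = sym (*-identityˡ _)
  det-move n pre y (m ∷ mid) post = begin
    det n (pre ++ y ∷ m ∷ mid ++ post)
      ≈⟨ det-swap n pre y m _ ⟩
    - det n (pre ++ m ∷ y ∷ mid ++ post)
      ≡⟨ ≡.cong (λ rs → - det n rs) (++-∷-assoc pre m _) ⟩
    - det n ((pre ++ [ m ]) ++ y ∷ mid ++ post)
      ≈⟨ -‿cong (det-move n (pre ++ [ m ]) y mid post) ⟩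
    - (-1^ length mid * det n ((pre ++ [ m ]) ++ mid ++ y ∷ post))
      ≡⟨ ≡.cong (λ rs → - (-1^ length mid * det n rs)) (≡.sym (++-∷-assoc pre m _)) ⟩
    - (-1^ length mid * det n (pre ++ m ∷ mid ++ y ∷ post))
      ≈⟨ -‿distribˡ-* _ _ ⟩
    - -1^ length mid * det n (pre ++ m ∷ mid ++ y ∷ post)
      ≈⟨ *-congʳ (-1*x≈-x _) ⟨
    -1^ length (m ∷ mid) * det n (pre ++ m ∷ mid ++ y ∷ post) ∎

  mutual
    det-zero-column : ∀ n rs → All (λ r → r zero ≈ 0#) rs → det (suc n) rs ≈ 0#
    det-zero-column n []       _            = refl
    det-zero-column n (r ∷ rs) (r₀≈0 ∷ rs₀≈0) = begin
      det (suc n) (r ∷ rs)                       ≈⟨ det-pivot n r rs rs₀≈0 ⟩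
      r zero * det n (dropColumn zero rs)        ≈⟨ *-congʳ r₀≈0 ⟩
      0# * det n (dropColumn zero rs)            ≈⟨ zeroˡ _ ⟩
      0# ∎

    det-pivot : ∀ n b rs → All (λ r → r zero ≈ 0#) rs →
                det (suc n) (b ∷ rs) ≈ b zero * det n (dropColumn zero rs)
    det-pivot zero    b rs _      = trans (+-identityʳ _) (*-identityˡ _)
    det-pivot (suc n) b rs rs₀≈0 = trans (+-cong (*-identityˡ _) (sum-≈0 λ j →
      trans (*-congˡ { -1^ toℕ (suc j)} (*-congˡ {b (suc j)}
              (det-zero-column n (dropColumn (suc j) rs) (All.map⁺ {f = λ r → removeAt r (suc j)} rs₀≈0))))
            (trans (*-congˡ { -1^ toℕ (suc j)} (zeroʳ _)) (zeroʳ _))))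
      (+-identityʳ _)

module LinearAlgebra {c ℓ : Level} {q : ℕ} (F : FiniteField c ℓ q) where
  open FieldProperties F
  open Determinant commRing
  open import Algebra.Properties.Semiring.Sum semiring
    using (sum; sum-cong-≋; ∑-distrib-+; *-distribˡ-sum; sum-replicate-zero)

  ev≡sum : ∀ {n} (β x : Row n) → ev F β x ≡ sum (λ i → β i * x i)
  ev≡sum {zero}  β x = ≡.refl
  ev≡sum {suc n} β x = ≡.cong (λ r → β zero * x zero + r) (ev≡sum (β ∘ suc) (x ∘ suc))

  ev-cofactor : ∀ {n} x (rs : List (Row (suc n))) → ev F (cofactor rs) x ≈ det (suc n) (x ∷ rs)
  ev-cofactor x rs = trans (reflexive (ev≡sum (cofactor rs) x)) (sym (det-expand x rs))

  ev-cong : ∀ {n} {β β′ x x′ : Row n} → (∀ i → β i ≈ β′ i) → (∀ i → x i ≈ x′ i) → ev F β x ≈ ev F β′ x′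
  ev-cong {β = β} {β′} {x} {x′} β≈β′ x≈x′ = begin
    ev F β x                  ≡⟨ ev≡sum β x ⟩
    sum (λ i → β i * x i)     ≈⟨ sum-cong-≋ (λ i → *-cong (β≈β′ i) (x≈x′ i)) ⟩
    sum (λ i → β′ i * x′ i)   ≡⟨ ev≡sum β′ x′ ⟨
    ev F β′ x′                ∎

  private
    sum-linear : ∀ {n} a (f g h : Row n) →
      sum (λ i → (a * f i + g i) * h i) ≈ a * sum (λ i → f i * h i) + sum (λ i → g i * h i)
    sum-linear a f g h = begin
      sum (λ i → (a * f i + g i) * h i)
        ≈⟨ sum-cong-≋ (λ i → solve 4 (λ a f g h → (a :* f :+ g) :* h := a :* (f :* h) :+ g :* h)
                                 refl a (f i) (g i) (h i)) ⟩
      sum (λ i → a * (f i * h i) + g i * h i)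
        ≈⟨ ∑-distrib-+ (λ i → a * (f i * h i)) (λ i → g i * h i) ⟩
      sum (λ i → a * (f i * h i)) + sum (λ i → g i * h i)
        ≈⟨ +-congʳ (*-distribˡ-sum a (λ i → f i * h i)) ⟨
      a * sum (λ i → f i * h i) + sum (λ i → g i * h i) ∎

  ev-linearˡ : ∀ {n} a (β γ x : Row n) → ev F (λ i → a * β i + γ i) x ≈ a * ev F β x + ev F γ x
  ev-linearˡ a β γ x = begin
    ev F (λ i → a * β i + γ i) x                     ≡⟨ ev≡sum _ x ⟩
    sum (λ i → (a * β i + γ i) * x i)                ≈⟨ sum-linear a β γ x ⟩
    a * sum (λ i → β i * x i) + sum (λ i → γ i * x i) ≡⟨ ≡.cong₂ (λ u v → a * u + v) (ev≡sum β x) (ev≡sum γ x) ⟨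
    a * ev F β x + ev F γ x                           ∎

  ev-linearʳ : ∀ {n} (β : Row n) a x y → ev F β (λ i → a * x i + y i) ≈ a * ev F β x + ev F β y
  ev-linearʳ β a x y = begin
    ev F β (λ i → a * x i + y i)                      ≡⟨ ev≡sum β _ ⟩
    sum (λ i → β i * (a * x i + y i))                 ≈⟨ sum-cong-≋ (λ i → *-comm (β i) _) ⟩
    sum (λ i → (a * x i + y i) * β i)                 ≈⟨ sum-linear a x y β ⟩
    a * sum (λ i → x i * β i) + sum (λ i → y i * β i) ≈⟨ +-cong (*-congˡ (sum-cong-≋ λ i → *-comm (x i) (β i)))
                                                                 (sum-cong-≋ λ i → *-comm (y i) (β i)) ⟩
    a * sum (λ i → β i * x i) + sum (λ i → β i * y i) ≡⟨ ≡.cong₂ (λ u v → a * u + v) (ev≡sum β x) (ev≡sum β y) ⟨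
    a * ev F β x + ev F β y                           ∎

  ev-*ˡ : ∀ {n} a (β x : Row n) → ev F (λ i → a * β i) x ≈ a * ev F β x
  ev-*ˡ a β x = begin
    ev F (λ i → a * β i) x        ≡⟨ ev≡sum _ x ⟩
    sum (λ i → a * β i * x i)     ≈⟨ sum-cong-≋ (λ i → *-assoc a (β i) (x i)) ⟩
    sum (λ i → a * (β i * x i))   ≈⟨ *-distribˡ-sum a (λ i → β i * x i) ⟨
    a * sum (λ i → β i * x i)     ≡⟨ ≡.cong (a *_) (ev≡sum β x) ⟨
    a * ev F β x                  ∎

  ev-zero : ∀ {n} (β : Row n) → ev F β (λ _ → 0#) ≈ 0#
  ev-zero {n} β =
    trans (reflexive (ev≡sum β _)) (trans (sum-cong-≋ λ i → zeroʳ (β i)) (sum-replicate-zero n))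

  -- surplus coefficients or rows are ignored
  lincomb : ∀ {n} → List Carrier → List (Row n) → Row n
  lincomb (a ∷ as) (r ∷ rs) i = a * r i + lincomb as rs i
  lincomb []       _        i = 0#
  lincomb (_ ∷ _)  []       i = 0#

  infix 4 _∈Span_
  _∈Span_ : ∀ {n} → Row n → List (Row n) → Set (c ⊔ ℓ)
  x ∈Span rs = ∃ λ as → ∀ i → lincomb as rs i ≈ x i

  Spanning : ∀ {n} → List (Row n) → Set (c ⊔ ℓ)
  Spanning rs = ∀ x → x ∈Span rs

  ev-lincomb : ∀ {n} (β : Row n) as rs → All (λ r → ev F β r ≈ 0#) rs → ev F β (lincomb as rs) ≈ 0#
  ev-lincomb β []       rs       _          = ev-zero β
  ev-lincomb β (a ∷ as) []       _          = ev-zero β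
  ev-lincomb β (a ∷ as) (r ∷ rs) (βr≈0 ∷ βrs≈0) = begin
    ev F β (lincomb (a ∷ as) (r ∷ rs))            ≈⟨ ev-linearʳ β a r (lincomb as rs) ⟩
    a * ev F β r + ev F β (lincomb as rs)         ≈⟨ +-cong (*-congˡ βr≈0) (ev-lincomb β as rs βrs≈0) ⟩
    a * 0# + 0#                                   ≈⟨ trans (+-identityʳ _) (zeroʳ a) ⟩
    0#                                            ∎

  ev-vanishes : ∀ {n} (β : Row n) rs → Spanning rs → All (λ r → ev F β r ≈ 0#) rs → ∀ x → ev F β x ≈ 0#
  ev-vanishes β rs spans βrs≈0 x =
    let as , as≈x = spans x in
    trans (ev-cong (λ _ → refl) (λ i → sym (as≈x i))) (ev-lincomb β as rs βrs≈0)

  ∈Span-resp : ∀ {n} {rs : List (Row n)} {u v} → (∀ i → u i ≈ v i) → u ∈Span rs → v ∈Span rs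
  ∈Span-resp u≈v (as , as≈u) = as , λ i → trans (as≈u i) (u≈v i)

  infixr 5 _⊕_
  _⊕_ : List Carrier → List Carrier → List Carrier
  []       ⊕ bs       = bs
  (a ∷ as) ⊕ []       = a ∷ as
  (a ∷ as) ⊕ (b ∷ bs) = (a + b) ∷ (as ⊕ bs)

  lincomb-⊕ : ∀ {n} as bs (rs : List (Row n)) i → lincomb (as ⊕ bs) rs i ≈ lincomb as rs i + lincomb bs rs i
  lincomb-⊕ []       bs       rs       i = sym (+-identityˡ _)
  lincomb-⊕ (a ∷ as) []       rs       i = sym (+-identityʳ _)
  lincomb-⊕ (a ∷ as) (b ∷ bs) []       i = sym (+-identityʳ _)
  lincomb-⊕ (a ∷ as) (b ∷ bs) (r ∷ rs) i = begin
    (a + b) * r i + lincomb (as ⊕ bs) rs i                   ≈⟨ +-congˡ (lincomb-⊕ as bs rs i) ⟩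
    (a + b) * r i + (lincomb as rs i + lincomb bs rs i)      ≈⟨ solve 5 (λ a b r x y → (a :+ b) :* r :+ (x :+ y)
                                                                  := (a :* r :+ x) :+ (b :* r :+ y)) refl a b (r i) _ _ ⟩
    (a * r i + lincomb as rs i) + (b * r i + lincomb bs rs i) ∎

  lincomb-scale : ∀ {n} a as (rs : List (Row n)) i → lincomb (map (a *_) as) rs i ≈ a * lincomb as rs i
  lincomb-scale a []       rs       i = sym (zeroʳ a)
  lincomb-scale a (b ∷ as) []       i = sym (zeroʳ a)
  lincomb-scale a (b ∷ as) (r ∷ rs) i = trans (+-congˡ (lincomb-scale a as rs i))
    (solve 4 (λ a b r x → a :* b :* r :+ a :* x := a :* (b :* r :+ x)) refl a b (r i) (lincomb as rs i))

  ∈Span-linear : ∀ {n} {rs : List (Row n)} a {u v} → u ∈Span rs → v ∈Span rs → (λ i → a * u i + v i) ∈Span rs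
  ∈Span-linear {rs = rs} a (as , as≈u) (bs , bs≈v) = map (a *_) as ⊕ bs , λ i →
    trans (lincomb-⊕ (map (a *_) as) bs rs i) (+-cong (trans (lincomb-scale a as rs i) (*-congˡ (as≈u i))) (bs≈v i))

  ∈Span-∷ : ∀ {n} {rs : List (Row n)} r {x} → x ∈Span rs → x ∈Span (r ∷ rs)
  ∈Span-∷ r ([]     , as≈x) = [] , as≈x
  ∈Span-∷ r (a ∷ as , as≈x) = 0# ∷ a ∷ as , λ i → trans (+-congʳ (zeroˡ _)) (trans (+-identityˡ _) (as≈x i))

  ∈Span-self : ∀ {n} (rs : List (Row n)) → All (_∈Span rs) rs
  ∈Span-self []       = []
  ∈Span-self (r ∷ rs) = (1# ∷ [] , λ i → trans (+-identityʳ _) (*-identityˡ _)) ∷ All.map (∈Span-∷ r) (∈Span-self rs)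

  ∈Span-trans : ∀ {n} {rs rs′ : List (Row n)} {x} → x ∈Span rs → All (_∈Span rs′) rs → x ∈Span rs′
  ∈Span-trans {rs = []}     ([]     , as≈x) []           = [] , as≈x
  ∈Span-trans {rs = []}     (a ∷ as , as≈x) []           = [] , as≈x
  ∈Span-trans {rs = r ∷ rs} ([]     , as≈x) _            = [] , as≈x
  ∈Span-trans {rs = r ∷ rs} (a ∷ as , as≈x) (r∈ ∷ rs∈) =
    ∈Span-resp as≈x (∈Span-linear a r∈ (∈Span-trans (as , λ _ → refl) rs∈))

  lincomb-zero-column : ∀ {n} as (rs : List (Row (suc n))) → All (λ r → r zero ≈ 0#) rs →
                        lincomb as rs zero ≈ 0#
  lincomb-zero-column []       rs       _              = refl
  lincomb-zero-column (a ∷ as) []       _              = refl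
  lincomb-zero-column (a ∷ as) (r ∷ rs) (r₀≈0 ∷ rs₀≈0) =
    trans (+-cong (trans (*-congˡ r₀≈0) (zeroʳ a)) (lincomb-zero-column as rs rs₀≈0)) (+-identityʳ 0#)

  lincomb-dropColumn : ∀ {n} as (rs : List (Row (suc n))) i →
                       lincomb as (dropColumn zero rs) i ≡ lincomb as rs (suc i)
  lincomb-dropColumn []       rs       i = ≡.refl
  lincomb-dropColumn (a ∷ as) []       i = ≡.refl
  lincomb-dropColumn (a ∷ as) (r ∷ rs) i = ≡.cong (λ t → a * r (suc i) + t) (lincomb-dropColumn as rs i)

  det-add-row : ∀ n pre a (u r : Row n) post → det n (pre ++ u ∷ post) ≈ 0# →
                det n (pre ++ (λ i → a * u i + r i) ∷ post) ≈ det n (pre ++ r ∷ post)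
  det-add-row n pre a u r post u-degenerate = begin
    det n (pre ++ (λ i → a * u i + r i) ∷ post)            ≈⟨ det-linear n pre a u r post ⟩
    a * det n (pre ++ u ∷ post) + det n (pre ++ r ∷ post)  ≈⟨ +-congʳ (trans (*-congˡ u-degenerate) (zeroʳ a)) ⟩
    0# + det n (pre ++ r ∷ post)                           ≈⟨ +-identityˡ _ ⟩
    det n (pre ++ r ∷ post)                                ∎

  module Elimination {n} (b : Row (suc n)) (b₀≉0 : b zero ≉ 0#) where

    eliminate : Row (suc n) → Row (suc n)
    eliminate r i = - (r zero * b zero ⁻¹) * b i + r i

    eliminate-zero : ∀ r → eliminate r zero ≈ 0#
    eliminate-zero r = begin
      - (r zero * b zero ⁻¹) * b zero + r zero   ≈⟨ +-congʳ (-‿distribˡ-* _ _) ⟨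
      - (r zero * b zero ⁻¹ * b zero) + r zero   ≈⟨ +-congʳ (-‿cong (x*y⁻¹*y≈x (r zero) b₀≉0)) ⟩
      - r zero + r zero                          ≈⟨ -‿inverseˡ (r zero) ⟩
      0#                                         ∎

    det-eliminate : ∀ pre rs → det (suc n) (b ∷ pre ++ rs) ≈ det (suc n) (b ∷ pre ++ map eliminate rs)
    det-eliminate pre []       = refl
    det-eliminate pre (r ∷ rs) = begin
      det (suc n) (b ∷ pre ++ r ∷ rs)                       ≡⟨ ≡.cong (λ rs′ → det (suc n) (b ∷ rs′)) (++-∷-assoc pre r rs) ⟩
      det (suc n) (b ∷ (pre ++ [ r ]) ++ rs)                ≈⟨ det-eliminate (pre ++ [ r ]) rs ⟩
      det (suc n) (b ∷ (pre ++ [ r ]) ++ map eliminate rs)  ≡⟨ ≡.cong (λ rs′ → det (suc n) (b ∷ rs′)) (++-∷-assoc pre r _) ⟨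
      det (suc n) (b ∷ pre ++ r ∷ map eliminate rs)         ≈⟨ det-add-row (suc n) (b ∷ pre) _ b r (map eliminate rs)
                                                                 (det-repeat (suc n) [] b pre (map eliminate rs)) ⟨
      det (suc n) (b ∷ pre ++ eliminate r ∷ map eliminate rs) ∎

    eliminated-zero-column : ∀ rs → All (λ r → r zero ≈ 0#) (map eliminate rs)
    eliminated-zero-column rs = All.map⁺ (All.tabulate (λ {r} _ → eliminate-zero r))

    det-eliminated : ∀ rs → det (suc n) (b ∷ rs) ≈ b zero * det n (dropColumn zero (map eliminate rs))
    det-eliminated rs = trans (det-eliminate [] rs) (det-pivot n b (map eliminate rs) (eliminated-zero-column rs))

    spanning-eliminated : ∀ rs → Spanning (b ∷ rs) → Spanning (dropColumn zero (map eliminate rs))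
    spanning-eliminated rs spans x = with-first-coefficient (∈Span-trans (spans 0∷x) old∈new)
      where
      0∷x : Row (suc n)
      0∷x zero    = 0#
      0∷x (suc i) = x i
      new = b ∷ map eliminate rs
      new∈new = ∈Span-self new
      old∈new : All (_∈Span new) (b ∷ rs)
      old∈new = All.head new∈new ∷ All.map
        (λ {r} r∈ → ∈Span-resp (restore r) (∈Span-linear (r zero * b zero ⁻¹) (All.head new∈new) r∈))
        (All.map⁻ (All.tail new∈new))
        where
        restore : ∀ r i → r zero * b zero ⁻¹ * b i + eliminate r i ≈ r i
        restore r i = solve 3 (λ c b r → c :* b :+ ((:- c) :* b :+ r) := r) refl (r zero * b zero ⁻¹) (b i) (r i)
      -- the eliminated rows vanish in column 0, so b gets coefficient 0
      with-first-coefficient : 0∷x ∈Span new → x ∈Span dropColumn zero (map eliminate rs)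
      with-first-coefficient ([]     , as≈x) = [] , λ i → as≈x (suc i)
      with-first-coefficient (a ∷ as , as≈x) = as , λ i → begin
        lincomb as (dropColumn zero (map eliminate rs)) i ≡⟨ lincomb-dropColumn as (map eliminate rs) i ⟩
        lincomb as (map eliminate rs) (suc i)              ≈⟨ +-identityˡ _ ⟨
        0# + lincomb as (map eliminate rs) (suc i)         ≈⟨ +-congʳ (trans (*-congʳ a≈0) (zeroˡ _)) ⟨
        a * b (suc i) + lincomb as (map eliminate rs) (suc i) ≈⟨ as≈x (suc i) ⟩
        x i                                               ∎
        where
        a≈0 : a ≈ 0#
        a≈0 = x*y≈0⇒x≈0 b₀≉0 (begin
          a * b zero                                         ≈⟨ +-identityʳ _ ⟨
          a * b zero + 0#                                    ≈⟨ +-congˡ (lincomb-zero-column as _ (eliminated-zero-column rs)) ⟨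
          a * b zero + lincomb as (map eliminate rs) zero    ≈⟨ as≈x zero ⟩
          0#                                                 ∎)

  det-pivoted-≉0 : ∀ {n} b rs → b zero ≉ 0# → length rs ≡ n → Spanning (b ∷ rs) →
                   (∀ rs′ → length rs′ ≡ n → Spanning rs′ → det n rs′ ≉ 0#) →
                   det (suc n) (b ∷ rs) ≉ 0#
  det-pivoted-≉0 {n} b rs b₀≉0 len spans det-≉0 det≈0 =
    *-≉0 b₀≉0 (det-≉0 _ len′ (spanning-eliminated rs spans)) (trans (sym (det-eliminated rs)) det≈0)
    where
    open Elimination b b₀≉0
    len′ : length (dropColumn zero (map eliminate rs)) ≡ n
    len′ = ≡.trans (List.length-map _ (map eliminate rs)) (≡.trans (List.length-map eliminate rs) len)

  det-spanning-≉0 : ∀ n (rs : List (Row n)) → length rs ≡ n → Spanning rs → det n rs ≉ 0#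
  det-spanning-≉0 zero    []       _   _     = 1≉0
  det-spanning-≉0 (suc n) (b ∷ rs) len spans with b zero ≟ 0# | All.all? (λ r → r zero ≟ 0#) rs
  ... | no b₀≉0  | _         = det-pivoted-≉0 b rs b₀≉0 (ℕP.suc-injective len) spans (det-spanning-≉0 n)
  ... | yes b₀≈0 | yes rs₀≈0 = λ _ → 1≉0 (trans (sym (proj₂ (spans e₀) zero))
                                               (lincomb-zero-column (proj₁ (spans e₀)) (b ∷ rs) (b₀≈0 ∷ rs₀≈0)))
    where
    e₀ : Row (suc n)
    e₀ zero    = 1#
    e₀ (suc i) = 0#
  ... | yes b₀≈0 | no ¬rs₀≈0 with find (¬All⇒Any¬ (λ r → r zero ≟ 0#) rs ¬rs₀≈0)
  ...   | piv , piv∈rs , piv₀≉0 with ∈-∃++ piv∈rs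
  ...     | pre , post , ≡.refl = λ det≈0 →
    det-pivoted-≉0 b′ rs b′₀≉0 (ℕP.suc-injective len) spans′ (det-spanning-≉0 n)
      (trans (det-add-row (suc n) [] 1# piv b rs (det-repeat (suc n) [] piv pre post)) det≈0)
    where
    b′ : Row (suc n)
    b′ i = 1# * piv i + b i
    b′₀≉0 : b′ zero ≉ 0#
    b′₀≉0 b′₀≈0 = piv₀≉0 (trans (sym (trans (+-congˡ b₀≈0) (trans (+-identityʳ _) (*-identityˡ _)))) b′₀≈0)
    new∈new = ∈Span-self (b′ ∷ rs)
    spans′ : Spanning (b′ ∷ rs)
    spans′ x = ∈Span-trans (spans x)
      (∈Span-resp (λ i → solve 2 (λ p b → :- con (ℤ.+ 1) :* p :+ (con (ℤ.+ 1) :* p :+ b) := b) refl (piv i) (b i))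
                  (∈Span-linear (- 1#) (All.lookup new∈new (there piv∈rs)) (All.head new∈new))
       ∷ All.tail new∈new)

module _ {a p} {A : Set a} {P : A → Set p} where

  All-remove : ∀ xs {y} ys → All P (xs ++ y ∷ ys) → All P (xs ++ ys)
  All-remove []       ys (_ ∷ pys)   = pys
  All-remove (x ∷ xs) ys (px ∷ pxs) = px ∷ All-remove xs ys pxs

  Any-remove : ∀ xs {y} ys → Any P (xs ++ y ∷ ys) → P y ⊎ Any P (xs ++ ys)
  Any-remove xs ys p with Any.++⁻ xs p
  ... | inj₁ p∈xs         = inj₂ (Any.++⁺ˡ p∈xs)
  ... | inj₂ (here py)    = inj₁ py
  ... | inj₂ (there p∈ys) = inj₂ (Any.++⁺ʳ xs p∈ys)

module _ {a r} {A : Set a} {R : A → A → Set r} where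

  AllPairs-remove : ∀ xs {y} ys → AllPairs R (xs ++ y ∷ ys) → AllPairs R (xs ++ ys)
  AllPairs-remove []       ys (_ ∷ rys)   = rys
  AllPairs-remove (x ∷ xs) ys (rx ∷ rxs) = All-remove xs ys rx ∷ AllPairs-remove xs ys rxs

  AllPairs-removed : (∀ {x y} → R x y → R y x) → ∀ xs {y} ys → AllPairs R (xs ++ y ∷ ys) → All (R y) (xs ++ ys)
  AllPairs-removed R-sym []       ys (ry ∷ _)   = ry
  AllPairs-removed R-sym (x ∷ xs) ys (rx ∷ rxs) =
    R-sym (All.lookup rx (Any.++⁺ʳ xs (here ≡.refl))) ∷ AllPairs-removed R-sym xs ys rxs

  AllPairs-mapWith : ∀ {p s} {P : A → Set p} {S : A → A → Set s} {xs} →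
    (∀ {x y} → P x → P y → R x y → S x y) → All P xs → AllPairs R xs → AllPairs S xs
  AllPairs-mapWith f []         []           = []
  AllPairs-mapWith f (px ∷ pxs) (rx ∷ rxs) =
    All.zipWith (λ (py , r) → f px py r) (pxs , rx) ∷ AllPairs-mapWith f pxs rxs

module Wilson {c ℓ : Level} {q : ℕ} (F : FiniteField c ℓ q) where
  open FieldProperties F
  open import Data.List.Membership.Setoid setoid using () renaming (_∈_ to _∈≈_)
  open import Data.List.Membership.Setoid.Properties using (∈-filter⁺)
  open import Data.List.Relation.Unary.Unique.Setoid setoid using (Unique)
  import Data.List.Relation.Unary.Unique.Setoid.Properties as Unique

  ≉-sym : ∀ {x y} → x ≉ y → y ≉ x
  ≉-sym x≉y y≈x = x≉y (sym y≈x)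

  module Involution (ι : Carrier → Carrier) (ι-cong : ∀ {x y} → x ≈ y → ι x ≈ ι y)
                    (ι-involutive : ∀ x → ι (ι x) ≈ x) where

    fixedPoints : List Carrier → List Carrier
    fixedPoints = filter (λ x → x ≟ ι x)

    fixedPoints-fixed : ∀ xs → All (λ x → x ≈ ι x) (fixedPoints xs)
    fixedPoints-fixed = All.all-filter (λ x → x ≟ ι x)

    fixedPoints-all : ∀ {p} {P : Carrier → Set p} {xs} → All P xs → All P (fixedPoints xs)
    fixedPoints-all = All.filter⁺ (λ x → x ≟ ι x)

    fixedPoints-unique : ∀ {xs} → Unique xs → Unique (fixedPoints xs)
    fixedPoints-unique = Unique.filter⁺ setoid (λ x → x ≟ ι x)

    ∈-fixedPoints : ∀ {x xs} → x ∈≈ xs → x ≈ ι x → x ∈≈ fixedPoints xs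
    ∈-fixedPoints = ∈-filter⁺ setoid (λ x → x ≟ ι x) λ x≈y x-fixed → trans (sym x≈y) (trans x-fixed (ι-cong x≈y))

    -- a point and its (distinct) image cancel in the product
    prod-fixedPoints : (g : Carrier → Carrier) → (∀ {x y} → x ≈ y → g x ≈ g y) →
      ∀ xs → Unique xs → All (λ x → ι x ∈≈ xs) xs → All (λ x → g x * g (ι x) ≈ 1#) xs →
      prod F (map g xs) ≈ prod F (map g (fixedPoints xs))
    prod-fixedPoints g g-cong xs = go (length xs) xs ℕP.≤-refl
      where
      go : ∀ n xs → length xs ≤ n → Unique xs → All (λ x → ι x ∈≈ xs) xs → All (λ x → g x * g (ι x) ≈ 1#) xs →
           prod F (map g xs) ≈ prod F (map g (fixedPoints xs))
      go _ [] _ _ _ _ = refl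
      go (suc n) (x ∷ xs) (s≤s len) (x≉xs ∷ uniq) (ιx∈ ∷ closed) (gx ∷ gs) with x ≟ ι x
      ... | yes x-fixed = *-congˡ (go n xs len uniq (All.zipWith stays (x≉xs , closed)) gs)
        where
        stays : ∀ {y} → x ≉ y × ι y ∈≈ (x ∷ xs) → ι y ∈≈ xs
        stays {y} (x≉y , here ιy≈x) = ⊥-elim (x≉y (trans x-fixed
          (trans (ι-cong (sym ιy≈x)) (ι-involutive y))))
        stays (_ , there ιy∈xs) = ιy∈xs
      ... | no x-moved with ιx∈
      ...   | here ιx≈x = ⊥-elim (x-moved (sym ιx≈x))
      ...   | there ιx∈xs with find ιx∈xs
      ...     | x′ , x′∈xs , ιx≈x′ with ∈-∃++ x′∈xs
      ...       | pre , post , ≡.refl = begin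
        g x * prod F (map g (pre ++ x′ ∷ post))      ≡⟨ ≡.cong (λ ys → g x * prod F ys) (List.map-++ g pre (x′ ∷ post)) ⟩
        g x * prod F (map g pre ++ g x′ ∷ map g post) ≈⟨ *-congˡ (prod-insert (map g pre) (g x′) (map g post)) ⟩
        g x * (g x′ * prod F (map g pre ++ map g post)) ≈⟨ *-assoc _ _ _ ⟨
        (g x * g x′) * prod F (map g pre ++ map g post) ≈⟨ *-congʳ (trans (*-congˡ (g-cong (sym ιx≈x′))) gx) ⟩
        1# * prod F (map g pre ++ map g post)         ≈⟨ *-identityˡ _ ⟩
        prod F (map g pre ++ map g post)               ≡⟨ ≡.cong (prod F) (List.map-++ g pre post) ⟨
        prod F (map g (pre ++ post))                   ≈⟨ go n (pre ++ post) len′ uniq′ closed′ (All-remove pre post gs) ⟩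
        prod F (map g (fixedPoints (pre ++ post)))     ≡⟨ ≡.cong (λ ys → prod F (map g ys)) fixedPoints-removed ⟨
        prod F (map g (fixedPoints (pre ++ x′ ∷ post))) ∎
        where
        x′-moved : ¬ x′ ≈ ι x′
        x′-moved x′-fixed = x-moved (sym (trans ιx≈x′ (trans x′-fixed (trans (ι-cong (sym ιx≈x′)) (ι-involutive x)))))
        fixedPoints-removed : fixedPoints (pre ++ x′ ∷ post) ≡ fixedPoints (pre ++ post)
        fixedPoints-removed = ≡.trans (List.filter-++ _ pre (x′ ∷ post))
          (≡.trans (≡.cong (fixedPoints pre ++_) (List.filter-reject (λ x → x ≟ ι x) {x′} {post} x′-moved))
                   (≡.sym (List.filter-++ _ pre post)))
        len′ : length (pre ++ post) ≤ n
        len′ = ℕP.≤-trans (ℕP.≤-reflexive (List.length-++ pre))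
                 (ℕP.≤-trans (ℕP.+-monoʳ-≤ (length pre) (ℕP.n≤1+n (length post)))
                   (ℕP.≤-trans (ℕP.≤-reflexive (≡.sym (List.length-++ pre))) len))
        uniq′ : Unique (pre ++ post)
        uniq′ = AllPairs-remove pre post uniq
        closed′ : All (λ y → ι y ∈≈ (pre ++ post)) (pre ++ post)
        closed′ = All.zipWith stays (All-remove pre post x≉xs ,
                                     All.zip (AllPairs-removed ≉-sym pre post uniq , All-remove pre post closed))
          where
          stays : ∀ {y} → x ≉ y × x′ ≉ y × ι y ∈≈ (x ∷ pre ++ x′ ∷ post) → ι y ∈≈ (pre ++ post)
          stays {y} (x≉y , x′≉y , here ιy≈x) =
            ⊥-elim (x′≉y (trans (sym ιx≈x′) (trans (ι-cong (sym ιy≈x)) (ι-involutive y))))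
          stays {y} (x≉y , x′≉y , there ιy∈) with Any-remove pre post ιy∈
          ... | inj₁ ιy≈x′ = ⊥-elim (x≉y (trans (sym (ι-involutive x))
                               (trans (ι-cong ιx≈x′) (trans (ι-cong (sym ιy≈x′)) (ι-involutive y)))))
          ... | inj₂ ιy∈′ = ιy∈′

  x*x≈1⇒x≈±1 : ∀ {x} → x * x ≈ 1# → x ≈ 1# ⊎ x ≈ - 1#
  x*x≈1⇒x≈±1 {x} x²≈1 with x ≟ 1#
  ... | yes x≈1 = inj₁ x≈1
  ... | no x≉1  = inj₂ (inverseˡ-unique x 1# (x*y≈0⇒x≈0 x-1≉0 (begin
    (x + 1#) * (x - 1#) ≈⟨ solve 1 (λ x → (x :+ con (ℤ.+ 1)) :* (x :- con (ℤ.+ 1)) := x :* x :- con (ℤ.+ 1)) refl x ⟩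
    x * x - 1#          ≈⟨ +-congʳ x²≈1 ⟩
    1# - 1#             ≈⟨ -‿inverseʳ 1# ⟩
    0#                  ∎)))
    where
    x-1≉0 : x - 1# ≉ 0#
    x-1≉0 x-1≈0 = x≉1 (begin
      x                ≈⟨ solve 1 (λ x → x := (x :- con (ℤ.+ 1)) :+ con (ℤ.+ 1)) refl x ⟩
      (x - 1#) + 1#    ≈⟨ +-congʳ x-1≈0 ⟩
      0# + 1#          ≈⟨ +-identityˡ 1# ⟩
      1#               ∎)

  prod-square-roots-of-1 : ∀ xs → Unique xs → All (λ x → x * x ≈ 1#) xs → - 1# ∈≈ xs → prod F xs ≈ - 1#
  prod-square-roots-of-1 (x ∷ xs) (x≉xs ∷ _) (_ ∷ xs²≈1) (here -1≈x) =
    trans (*-congʳ (sym -1≈x)) (trans (*-congˡ (prod-1 xs (All.zipWith ≈1 (x≉xs , xs²≈1)))) (*-identityʳ _))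
    where
    ≈1 : ∀ {y} → x ≉ y × y * y ≈ 1# → y ≈ 1#
    ≈1 {y} (x≉y , y²≈1) with x*x≈1⇒x≈±1 y²≈1
    ... | inj₁ y≈1  = y≈1
    ... | inj₂ y≈-1 = ⊥-elim (x≉y (trans (sym -1≈x) (sym y≈-1)))
    prod-1 : ∀ ys → All (_≈ 1#) ys → prod F ys ≈ 1#
    prod-1 []       []           = refl
    prod-1 (y ∷ ys) (y≈1 ∷ ys≈1) = trans (*-cong y≈1 (prod-1 ys ys≈1)) (*-identityˡ 1#)
  prod-square-roots-of-1 (x ∷ xs) (x≉xs ∷ uniq) (x²≈1 ∷ xs²≈1) (there -1∈xs) with x*x≈1⇒x≈±1 x²≈1
  ... | inj₁ x≈1  = trans (*-cong x≈1 (prod-square-roots-of-1 xs uniq xs²≈1 -1∈xs)) (*-identityˡ _)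
  ... | inj₂ x≈-1 = ⊥-elim (let y , y∈xs , -1≈y = find -1∈xs in All.lookup x≉xs y∈xs (trans x≈-1 -1≈y))

  wilson : ∀ xs → Unique xs → All (_≉ 0#) xs → (∀ x → x ≉ 0# → x ∈≈ xs) → prod F xs ≈ - 1#
  wilson xs uniq xs≉0 complete = begin
    prod F xs                          ≡⟨ ≡.cong (prod F) (List.map-id xs) ⟨
    prod F (map (λ x → x) xs)          ≈⟨ prod-fixedPoints (λ x → x) (λ x≈y → x≈y) xs uniq
                                            (All.map (λ x≉0 → complete _ (⁻¹-≉0 x≉0)) xs≉0)
                                            (All.map *-inverseʳ xs≉0) ⟩
    prod F (map (λ x → x) (fixedPoints xs)) ≡⟨ ≡.cong (prod F) (List.map-id (fixedPoints xs)) ⟩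
    prod F (fixedPoints xs)            ≈⟨ prod-square-roots-of-1 (fixedPoints xs) (fixedPoints-unique uniq)
                                            (All.zipWith (λ (x-fixed , x≉0) → trans (*-congˡ x-fixed) (*-inverseʳ x≉0))
                                                         (fixedPoints-fixed xs , fixedPoints-all xs≉0))
                                            (∈-fixedPoints (complete (- 1#) -1≉0) -1-fixed) ⟩
    - 1#                               ∎
    where
    open Involution _⁻¹ ⁻¹-cong ⁻¹-involutive
    -1≉0 : - 1# ≉ 0#
    -1≉0 -1≈0 = 1≉0 (trans (sym (-‿involutive 1#)) (trans (-‿cong -1≈0) ε⁻¹≈ε))
    -1-fixed : - 1# ≈ (- 1#) ⁻¹
    -1-fixed = sym (⁻¹-unique (trans (-1*x≈-x _) (-‿involutive 1#)))

  -- if 1# + 1# ≉ 0#, negation pairs off all elements but 0#, so q is odd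
  -1^[1+q]≈1 : -1^ suc q ≈ 1#
  -1^[1+q]≈1 with 1# + 1# ≟ 0#
  ... | yes 2≈0 = all-1 (suc q)
    where
    all-1 : ∀ n → -1^ n ≈ 1#
    all-1 zero    = refl
    all-1 (suc n) = trans (*-cong (sym (inverseˡ-unique 1# 1# 2≈0)) (all-1 n)) (*-identityˡ 1#)
  ... | no 2≉0 = begin
    - 1# * -1^ q                                       ≈⟨ *-congˡ -1^q≈-1 ⟩
    - 1# * - 1#                                        ≈⟨ trans (-1*x≈-x _) (-‿involutive 1#) ⟩
    1#                                                 ∎
    where
    open Involution -_ -‿cong -‿involutive
    elements : List Carrier
    elements = tabulate enum
    unique : Unique elements
    unique = Unique.tabulate⁺ setoid (λ {i} {j} → enum-inj i j)
    ∈-elements : ∀ x → x ∈≈ elements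
    ∈-elements x = let i , enumᵢ≈x = enum-surj x in
      Any.map (λ enumᵢ≡y → trans (sym enumᵢ≈x) (reflexive enumᵢ≡y)) (∈-tabulate⁺ i)
    fixed⇒0 : ∀ {x} → x ≈ - x → x ≈ 0#
    fixed⇒0 {x} x≈-x = x*y≈0⇒x≈0 2≉0 (begin
      x * (1# + 1#)      ≈⟨ distribˡ x 1# 1# ⟩
      x * 1# + x * 1#    ≈⟨ +-cong (*-identityʳ x) (*-identityʳ x) ⟩
      x + x              ≈⟨ +-congˡ x≈-x ⟩
      x - x              ≈⟨ -‿inverseʳ x ⟩
      0#                 ∎)
    only-zero : ∀ ys → Unique ys → All (_≈ 0#) ys → 0# ∈≈ ys → prod F (map (λ _ → - 1#) ys) ≈ - 1#
    only-zero (y ∷ [])     _                  _                   _ = *-identityʳ _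
    only-zero (y ∷ y′ ∷ _) ((y≉y′ ∷ _) ∷ _) (y≈0 ∷ y′≈0 ∷ _) _ = ⊥-elim (y≉y′ (trans y≈0 (sym y′≈0)))
    -1^q≈-1 : -1^ q ≈ - 1#
    -1^q≈-1 = begin
      -1^ q                                            ≡⟨ ≡.cong -1^_ (List.length-tabulate enum) ⟨
      -1^ length elements                              ≈⟨ prod-map-const (- 1#) elements ⟨
      prod F (map (λ _ → - 1#) elements)               ≈⟨ prod-fixedPoints (λ _ → - 1#) (λ _ → refl) elements
                                                            unique
                                                            (All.tabulate (λ {x} _ → ∈-elements (- x)))
                                                            (All.tabulate (λ _ → trans (-1*x≈-x _) (-‿involutive 1#))) ⟩
      prod F (map (λ _ → - 1#) (fixedPoints elements)) ≈⟨ only-zero (fixedPoints elements) (fixedPoints-unique unique)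
                                                            (All.map fixed⇒0 (fixedPoints-fixed elements))
                                                            (∈-fixedPoints (∈-elements 0#) (sym ε⁻¹≈ε)) ⟩
      - 1#                                             ∎

module SubsetElements where

  elements : ∀ {n} → Subset n → List (Fin n)
  elements []            = []
  elements (inside  ∷ p) = zero ∷ map suc (elements p)
  elements (outside ∷ p) = map suc (elements p)

  ∈⇒∈elements : ∀ {n} {p : Subset n} {i} → i ∈ p → i ∈ₗ elements p
  ∈⇒∈elements {p = inside  ∷ p} here      = here ≡.refl
  ∈⇒∈elements {p = inside  ∷ p} (there i∈p) = there (∈-map⁺ suc (∈⇒∈elements i∈p))
  ∈⇒∈elements {p = outside ∷ p} (there i∈p) = ∈-map⁺ suc (∈⇒∈elements i∈p)

  ∈elements⇒∈ : ∀ {n} {p : Subset n} {i} → i ∈ₗ elements p → i ∈ p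
  ∈elements⇒∈ {p = inside  ∷ p} (here ≡.refl) = here
  ∈elements⇒∈ {p = inside  ∷ p} (there i∈) with ∈-map⁻ suc i∈
  ... | j , j∈ , ≡.refl = there (∈elements⇒∈ j∈)
  ∈elements⇒∈ {p = outside ∷ p} i∈ with ∈-map⁻ suc i∈
  ... | j , j∈ , ≡.refl = there (∈elements⇒∈ j∈)

  length-elements : ∀ {n} (p : Subset n) → length (elements p) ≡ ∣ p ∣
  length-elements []            = ≡.refl
  length-elements (inside  ∷ p) = ≡.cong suc (≡.trans (List.length-map suc (elements p)) (length-elements p))
  length-elements (outside ∷ p) = ≡.trans (List.length-map suc (elements p)) (length-elements p)

  private
    map-suc-distinct : ∀ {n} {l : List (Fin n)} → AllPairs _≢_ l → AllPairs _≢_ (map suc l)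
    map-suc-distinct d = AllPairs.map⁺ (AllPairs.map (λ i≢j sucᵢ≡sucⱼ → i≢j (FinP.suc-injective sucᵢ≡sucⱼ)) d)

  elements-distinct : ∀ {n} (p : Subset n) → AllPairs _≢_ (elements p)
  elements-distinct []            = []
  elements-distinct (inside  ∷ p) = All.map⁺ (All.tabulate (λ _ ())) ∷ map-suc-distinct (elements-distinct p)
  elements-distinct (outside ∷ p) = map-suc-distinct (elements-distinct p)

  ∉⇒≢elements : ∀ {n} {p : Subset n} {i} → i ∉ p → All (i ≢_) (elements p)
  ∉⇒≢elements i∉p = All.tabulate λ j∈ i≡j → i∉p (≡.subst (_∈ _) (≡.sym i≡j) (∈elements⇒∈ j∈))

  private
    ∩-all : ∀ {n} (p : Subset n) → p ∩ Vec.tabulate (λ _ → true) ≡ p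
    ∩-all []            = ≡.refl
    ∩-all (inside  ∷ p) = ≡.cong (inside ∷_) (∩-all p)
    ∩-all (outside ∷ p) = ≡.cong (outside ∷_) (∩-all p)

  -- τ A y counts the elements of A after y, i.e. those in L₂
  elements-insert : ∀ {n} (A : Subset n) y → y ∉ A →
    ∃ λ L₁ → ∃ λ L₂ → elements (A ∪ ⁅ y ⁆) ≡ L₁ ++ y ∷ L₂ × elements A ≡ L₁ ++ L₂ × length L₂ ≡ τ A y
  elements-insert (inside  ∷ A) zero y∉A = ⊥-elim (y∉A here)
  elements-insert (outside ∷ A) zero y∉A = [] , map suc (elements A) ,
    ≡.cong (λ B → zero ∷ map suc (elements B)) (∪-identityʳ A) , ≡.refl ,
    ≡.trans (List.length-map suc (elements A)) (≡.trans (length-elements A) (≡.cong ∣_∣ (≡.sym (∩-all A))))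
  elements-insert (a ∷ A) (suc y) y∉A with elements-insert A y (λ y∈A → y∉A (there y∈A))
  elements-insert (inside ∷ A) (suc y) y∉A | L₁ , L₂ , A∪y≡ , A≡ , len =
    zero ∷ map suc L₁ , map suc L₂ ,
    ≡.cong (zero ∷_) (≡.trans (≡.cong (map suc) A∪y≡) (List.map-++ suc L₁ (y ∷ L₂))) ,
    ≡.cong (zero ∷_) (≡.trans (≡.cong (map suc) A≡) (List.map-++ suc L₁ L₂)) ,
    ≡.trans (List.length-map suc L₂) len
  elements-insert (outside ∷ A) (suc y) y∉A | L₁ , L₂ , A∪y≡ , A≡ , len =
    map suc L₁ , map suc L₂ ,
    ≡.trans (≡.cong (map suc) A∪y≡) (List.map-++ suc L₁ (y ∷ L₂)) ,
    ≡.trans (≡.cong (map suc) A≡) (List.map-++ suc L₁ L₂) ,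
    ≡.trans (List.length-map suc L₂) len

  ⊆∧∣∣≡⇒≡ : ∀ {n} (A C : Subset n) → A ⊆ C → ∣ C ∣ ≡ ∣ A ∣ → C ≡ A
  ⊆∧∣∣≡⇒≡ []            []            _   _ = ≡.refl
  ⊆∧∣∣≡⇒≡ (inside  ∷ A) (outside ∷ C) A⊆C _ with A⊆C here
  ... | ()
  ⊆∧∣∣≡⇒≡ (inside  ∷ A) (inside  ∷ C) A⊆C e = ≡.cong (inside ∷_) (⊆∧∣∣≡⇒≡ A C (drop-∷-⊆ A⊆C) (ℕP.suc-injective e))
  ⊆∧∣∣≡⇒≡ (outside ∷ A) (outside ∷ C) A⊆C e = ≡.cong (outside ∷_) (⊆∧∣∣≡⇒≡ A C (drop-∷-⊆ A⊆C) e)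
  ⊆∧∣∣≡⇒≡ (outside ∷ A) (inside  ∷ C) A⊆C e =
    ⊥-elim (ℕP.<-irrefl ≡.refl (ℕP.≤-trans (ℕP.≤-reflexive e) (p⊆q⇒∣p∣≤∣q∣ (drop-∷-⊆ A⊆C))))

  ⊆∧∣∣≡suc⇒insert : ∀ {n} (A C : Subset n) → A ⊆ C → ∣ C ∣ ≡ suc ∣ A ∣ →
    ∃ λ y → first (C ─ A) ≡ just y × C ≡ A ∪ ⁅ y ⁆ × y ∉ A
  ⊆∧∣∣≡suc⇒insert []            []            _   ()
  ⊆∧∣∣≡suc⇒insert (inside  ∷ A) (outside ∷ C) A⊆C _ with A⊆C here
  ... | ()
  ⊆∧∣∣≡suc⇒insert (outside ∷ A) (inside  ∷ C) A⊆C e = zero , ≡.refl ,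
    ≡.cong (inside ∷_) (≡.trans (⊆∧∣∣≡⇒≡ A C (drop-∷-⊆ A⊆C) (ℕP.suc-injective e)) (≡.sym (∪-identityʳ A))) , λ ()
  ⊆∧∣∣≡suc⇒insert (inside  ∷ A) (inside  ∷ C) A⊆C e
    with ⊆∧∣∣≡suc⇒insert A C (drop-∷-⊆ A⊆C) (ℕP.suc-injective e)
  ... | y , first≡ , C≡ , y∉A = suc y , ≡.cong (Maybe.map suc) first≡ , ≡.cong (inside ∷_) C≡ , λ y∈ → y∉A (drop-there y∈)
  ⊆∧∣∣≡suc⇒insert (outside ∷ A) (outside ∷ C) A⊆C e
    with ⊆∧∣∣≡suc⇒insert A C (drop-∷-⊆ A⊆C) e
  ... | y , first≡ , C≡ , y∉A = suc y , ≡.cong (Maybe.map suc) first≡ , ≡.cong (outside ∷_) C≡ , λ y∈ → y∉A (drop-there y∈)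

  ∁-insert : ∀ {n} (B : Subset n) z → z ∉ B → ∁ B ≡ ∁ (B ∪ ⁅ z ⁆) ∪ ⁅ z ⁆
  ∁-insert (inside  ∷ B) zero    z∉B = ⊥-elim (z∉B here)
  ∁-insert (outside ∷ B) zero    z∉B = ≡.cong (inside ∷_) (≡.sym (≡.trans (∪-identityʳ _) (≡.cong ∁ (∪-identityʳ B))))
  ∁-insert (inside  ∷ B) (suc z) z∉B = ≡.cong (outside ∷_) (∁-insert B z (λ z∈ → z∉B (there z∈)))
  ∁-insert (outside ∷ B) (suc z) z∉B = ≡.cong (inside ∷_) (∁-insert B z (λ z∈ → z∉B (there z∈)))

  first-∈ : ∀ {n} {p : Subset n} {i} → i ∈ p → ∃ λ j → first p ≡ just j × j ∈ p
  first-∈ {p = inside  ∷ p} _           = zero , ≡.refl , here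
  first-∈ {p = outside ∷ p} (there i∈p) with first-∈ i∈p
  ... | j , first≡ , j∈p = suc j , ≡.cong (Maybe.map suc) first≡ , there j∈p

  ∣p∣<n⇒∃∉ : ∀ {n} (p : Subset n) → ∣ p ∣ ℕ.< n → ∃ λ i → i ∉ p
  ∣p∣<n⇒∃∉ (outside ∷ p) _ = zero , λ ()
  ∣p∣<n⇒∃∉ (inside  ∷ p) (ℕ.s≤s lt) with ∣p∣<n⇒∃∉ p lt
  ... | i , i∉p = suc i , λ i∈ → i∉p (drop-there i∈)

  ∉∪⁅⁆ : ∀ {n} {A : Subset n} {u v} → u ∉ A → u ≢ v → u ∉ A ∪ ⁅ v ⁆
  ∉∪⁅⁆ {A = A} {v = v} u∉A u≢v u∈ with x∈p∪q⁻ A ⁅ v ⁆ u∈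
  ... | inj₁ u∈A = u∉A u∈A
  ... | inj₂ u∈v = u≢v (x∈⁅y⁆⇒x≡y v u∈v)

lookup-injective : ∀ {a} {A : Set a} {xs : List A} → AllPairs _≢_ xs → Injective _≡_ _≡_ (List.lookup xs)
lookup-injective (x≢xs ∷ _)     {zero}  {zero}  _ = ≡.refl
lookup-injective (x≢xs ∷ _)     {zero}  {suc j} e = ⊥-elim (All.lookup x≢xs (∈-lookup j) e)
lookup-injective (x≢xs ∷ _)     {suc i} {zero}  e = ⊥-elim (All.lookup x≢xs (∈-lookup i) (≡.sym e))
lookup-injective (_ ∷ distinct) {suc i} {suc j} e = ≡.cong suc (lookup-injective distinct e)

module ArcProperties {c ℓ : Level} {q : ℕ} (F : FiniteField c ℓ q) {k s : ℕ}
                     (S : Fin s → Vector F k) (arc : IsArc F S) where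
  open FieldProperties F
  open Determinant commRing
  open LinearAlgebra F

  lincomb-tabulate : ∀ (l : List (Fin s)) (a : Fin (length l) → Carrier) j →
    lincomb (List.tabulate a) (map S l) j ≈ Σ[_] F (λ i → a i * S (List.lookup l i) j)
  lincomb-tabulate []      a j = refl
  lincomb-tabulate (x ∷ l) a j = +-congˡ (lincomb-tabulate l (a ∘ suc) j)

  arc-spanning : ∀ l → length l ≡ k → AllPairs _≢_ l → Spanning (map S l)
  arc-spanning l ≡.refl distinct x =
    let a , a≈x = proj₂ (proj₂ arc (List.lookup l) (lookup-injective distinct)) x in
    List.tabulate a , λ j → trans (lincomb-tabulate l a j) (a≈x j)

  arc-det-≉0 : ∀ l → length l ≡ k → AllPairs _≢_ l → det k (map S l) ≉ 0#
  arc-det-≉0 l len distinct =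
    det-spanning-≉0 k (map S l) (≡.trans (List.length-map S l) len) (arc-spanning l len distinct)

  arc-ev-vanishes : ∀ β l → length l ≡ k → AllPairs _≢_ l → All (λ i → ev F β (S i) ≈ 0#) l →
                    ∀ x → ev F β x ≈ 0#
  arc-ev-vanishes β l len distinct βl≈0 =
    ev-vanishes β (map S l) (arc-spanning l len distinct) (All.map⁺ βl≈0)

module LemmaOfTangents {c ℓ : Level} {q : ℕ} (F : FiniteField c ℓ q) {s m : ℕ}
  (S : Fin s → Vector F (suc (suc m))) (A : Subset s) (T : List (Vector F (suc (suc m)))) where

  open FieldProperties F
  open Determinant commRing
  open LinearAlgebra F
  open Wilson F
  open SubsetElements

  private
    k : ℕ
    k = suc (suc m)
    α : List (Fin s)
    α = elements A

  φ : Fin s → Fin s → Carrier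
  φ v w = det k (map S (w ∷ v ∷ α))

  K : Fin s → Carrier
  K v = tangent F T (S v) * prod F (map (φ v) (elements (∁ (A ∪ ⁅ v ⁆))))

  -- x ↦ det (x, S v, S A), whose kernel is the hyperplane spanned by S v and S A
  hyperplane : Fin s → Row k
  hyperplane v = cofactor (map S (v ∷ α))

  φ≈hyperplane : ∀ v w → φ v w ≈ ev F (hyperplane v) (S w)
  φ≈hyperplane v w = sym (ev-cofactor (S w) (map S (v ∷ α)))

  hyperplane-A : ∀ v {a} → a ∈ₗ α → ev F (hyperplane v) (S a) ≈ 0#
  hyperplane-A v {a} a∈α with ∈-∃++ a∈α
  ... | pre , post , α≡ = begin
    ev F (hyperplane v) (S a)                      ≈⟨ φ≈hyperplane v a ⟨
    det k (S a ∷ S v ∷ map S α)                    ≡⟨ ≡.cong (λ rs → det k (S a ∷ S v ∷ rs))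
                                                        (≡.trans (≡.cong (map S) α≡) (List.map-++ S pre (a ∷ post))) ⟩
    det k (S a ∷ S v ∷ map S pre ++ S a ∷ map S post) ≈⟨ det-repeat k [] (S a) (S v ∷ map S pre) (map S post) ⟩
    0#                                             ∎

  hyperplane-self : ∀ v → ev F (hyperplane v) (S v) ≈ 0#
  hyperplane-self v = trans (sym (φ≈hyperplane v v)) (det-repeat₀ k (S v) (map S α))

  prod-∁-insert : ∀ (g : Fin s → Carrier) B {u} → u ∉ B →
    prod F (map g (elements (∁ B))) ≈ g u * prod F (map g (elements (∁ (B ∪ ⁅ u ⁆))))
  prod-∁-insert g B {u} u∉B with elements-insert (∁ (B ∪ ⁅ u ⁆)) u (x∈p⇒x∉∁p (x∈p∪q⁺ (inj₂ (x∈⁅x⁆ u))))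
  ... | L₁ , L₂ , ∁B≡ , ∁B∪u≡ , _ = begin
    prod F (map g (elements (∁ B)))                ≡⟨ ≡.cong (λ B′ → prod F (map g (elements B′))) (∁-insert B u u∉B) ⟩
    prod F (map g (elements (∁ (B ∪ ⁅ u ⁆) ∪ ⁅ u ⁆))) ≡⟨ ≡.cong (λ l → prod F (map g l)) ∁B≡ ⟩
    prod F (map g (L₁ ++ u ∷ L₂))                  ≡⟨ ≡.cong (prod F) (List.map-++ g L₁ (u ∷ L₂)) ⟩
    prod F (map g L₁ ++ g u ∷ map g L₂)            ≈⟨ prod-insert (map g L₁) (g u) (map g L₂) ⟩
    g u * prod F (map g L₁ ++ map g L₂)            ≡⟨ ≡.cong (λ l → g u * prod F l) (≡.trans (≡.sym (List.map-++ g L₁ L₂))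
                                                                                           (≡.cong (map g) (≡.sym ∁B∪u≡))) ⟩
    g u * prod F (map g (elements (∁ (B ∪ ⁅ u ⁆)))) ∎

  module _ (arc : IsArc F S) (∣A∣≡m : ∣ A ∣ ≡ m) (tangents : IsTangentList F S A T) where
    open ArcProperties F S arc

    distinct-with : ∀ {w v} → w ∉ A → v ∉ A → w ≢ v → AllPairs _≢_ (w ∷ v ∷ α)
    distinct-with w∉A v∉A w≢v = (w≢v ∷ ∉⇒≢elements w∉A) ∷ (∉⇒≢elements v∉A ∷ elements-distinct A)

    length-with : ∀ w v → length (w ∷ v ∷ α) ≡ k
    length-with w v = ≡.cong (λ n → suc (suc n)) (≡.trans (length-elements A) ∣A∣≡m)

    φ-≉0 : ∀ {v w} → v ∉ A → w ∉ A → w ≢ v → φ v w ≉ 0#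
    φ-≉0 {v} {w} v∉A w∉A w≢v = arc-det-≉0 (w ∷ v ∷ α) (length-with w v) (distinct-with w∉A v∉A w≢v)

    module Pencil (y z : Fin s) (y∉A : y ∉ A) (z∉A : z ∉ A) (y≢z : y ≢ z) where

      δ : Carrier
      δ = φ y z

      δ≉0 : δ ≉ 0#
      δ≉0 = φ-≉0 y∉A z∉A (y≢z ∘ ≡.sym)

      φzy≈-δ : φ z y ≈ - δ
      φzy≈-δ = det-swap k [] (S y) (S z) (map S α)

      pencil : Carrier → Row k
      pencil r j = - r * hyperplane z j + hyperplane y j

      ev-pencil : ∀ r x → ev F (pencil r) x ≈ - r * ev F (hyperplane z) x + ev F (hyperplane y) x
      ev-pencil r x = ev-linearˡ (- r) (hyperplane z) (hyperplane y) x

      ev-pencil-cong : ∀ {r r′} → r ≈ r′ → ∀ x → ev F (pencil r) x ≈ ev F (pencil r′) x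
      ev-pencil-cong r≈r′ x = trans (ev-pencil _ x) (trans (+-congʳ (*-congʳ (-‿cong r≈r′))) (sym (ev-pencil _ x)))

      pencil-y : ∀ r → ev F (pencil r) (S y) ≈ r * δ
      pencil-y r = begin
        ev F (pencil r) (S y)                                       ≈⟨ ev-pencil r (S y) ⟩
        - r * ev F (hyperplane z) (S y) + ev F (hyperplane y) (S y) ≈⟨ +-cong (*-congˡ (trans (sym (φ≈hyperplane z y)) φzy≈-δ))
                                                                               (hyperplane-self y) ⟩
        - r * - δ + 0#                                              ≈⟨ solve 2 (λ r d → (:- r) :* (:- d) :+ con (ℤ.+ 0) := r :* d) refl r δ ⟩
        r * δ                                                       ∎

      pencil-z : ∀ r → ev F (pencil r) (S z) ≈ δ
      pencil-z r = begin
        ev F (pencil r) (S z)                                       ≈⟨ ev-pencil r (S z) ⟩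
        - r * ev F (hyperplane z) (S z) + ev F (hyperplane y) (S z) ≈⟨ +-cong (*-congˡ (hyperplane-self z)) (sym (φ≈hyperplane y z)) ⟩
        - r * 0# + δ                                                ≈⟨ trans (+-congʳ (zeroʳ _)) (+-identityˡ δ) ⟩
        δ                                                           ∎

      pencil-A : ∀ r {a} → a ∈ₗ α → ev F (pencil r) (S a) ≈ 0#
      pencil-A r {a} a∈α = trans (ev-pencil r (S a))
        (trans (+-cong (trans (*-congˡ (hyperplane-A z a∈α)) (zeroʳ _)) (hyperplane-A y a∈α)) (+-identityʳ 0#))

      pencil-≢0 : ∀ r → NonZeroFun F (pencil r)
      pencil-≢0 r pencil≈0 = δ≉0 (trans (sym (pencil-z r))
        (trans (reflexive (ev≡sum (pencil r) (S z))) (sum-≈0 λ j → trans (*-congʳ {S z j} (pencil≈0 j)) (zeroˡ _))))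

      Tangent : Row k → Set ℓ
      Tangent = MeetsExactly F S A

      tangent-A : ∀ β → Tangent β → ∀ {a} → a ∈ₗ α → ev F β (S a) ≈ 0#
      tangent-A β tβ {a} a∈α = proj₂ (tβ a) (∈elements⇒∈ a∈α)

      tangent-≉0 : ∀ β → Tangent β → ∀ {w} → w ∉ A → ev F β (S w) ≉ 0#
      tangent-≉0 β tβ {w} w∉A βw≈0 = w∉A (proj₁ (tβ w) βw≈0)

      -- the functionals vanishing on A form the pencil spanned by hyperplane y and hyperplane z
      vanishing-on-A : ∀ β → (∀ {a} → a ∈ₗ α → ev F β (S a) ≈ 0#) → ∀ x →
        δ * ev F β x ≈ ev F β (S z) * ev F (hyperplane y) x - ev F β (S y) * ev F (hyperplane z) x
      vanishing-on-A β βα≈0 x = begin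
        δ * ev F β x
          ≈⟨ inverseˡ-unique _ _ (trans (sym (ev-ψ x)) (arc-ev-vanishes ψ (z ∷ y ∷ α) (length-with z y)
                                    (distinct-with z∉A y∉A (y≢z ∘ ≡.sym)) (ψ-z ∷ ψ-y ∷ All.tabulate ψ-A) x)) ⟩
        - (- βz * ev F (hyperplane y) x + βy * ev F (hyperplane z) x)
          ≈⟨ solve 4 (λ a u b v → :- ((:- a) :* u :+ b :* v) := a :* u :- b :* v) refl βz _ βy _ ⟩
        βz * ev F (hyperplane y) x - βy * ev F (hyperplane z) x ∎
        where
        βy = ev F β (S y)
        βz = ev F β (S z)
        ψ : Row k
        ψ j = δ * β j + (- βz * hyperplane y j + βy * hyperplane z j)
        ev-ψ : ∀ x → ev F ψ x ≈ δ * ev F β x + (- βz * ev F (hyperplane y) x + βy * ev F (hyperplane z) x)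
        ev-ψ x = trans (ev-linearˡ δ β (λ j → - βz * hyperplane y j + βy * hyperplane z j) x)
          (+-congˡ (trans (ev-linearˡ (- βz) (hyperplane y) (λ j → βy * hyperplane z j) x)
                          (+-congˡ (ev-*ˡ βy (hyperplane z) x))))
        ψ-z : ev F ψ (S z) ≈ 0#
        ψ-z = begin
          ev F ψ (S z)                                                     ≈⟨ ev-ψ (S z) ⟩
          δ * βz + (- βz * ev F (hyperplane y) (S z) + βy * ev F (hyperplane z) (S z))
            ≈⟨ +-congˡ (+-cong (*-congˡ (sym (φ≈hyperplane y z))) (*-congˡ (hyperplane-self z))) ⟩
          δ * βz + (- βz * δ + βy * 0#)
            ≈⟨ solve 3 (λ d b c → d :* b :+ ((:- b) :* d :+ c :* con (ℤ.+ 0)) := con (ℤ.+ 0)) refl δ βz βy ⟩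
          0# ∎
        ψ-y : ev F ψ (S y) ≈ 0#
        ψ-y = begin
          ev F ψ (S y)                                                     ≈⟨ ev-ψ (S y) ⟩
          δ * βy + (- βz * ev F (hyperplane y) (S y) + βy * ev F (hyperplane z) (S y))
            ≈⟨ +-congˡ (+-cong (*-congˡ (hyperplane-self y)) (*-congˡ (trans (sym (φ≈hyperplane z y)) φzy≈-δ))) ⟩
          δ * βy + (- βz * 0# + βy * - δ)
            ≈⟨ solve 3 (λ d b c → d :* c :+ ((:- b) :* con (ℤ.+ 0) :+ c :* (:- d)) := con (ℤ.+ 0)) refl δ βz βy ⟩
          0# ∎
        ψ-A : ∀ {a} → a ∈ₗ α → ev F ψ (S a) ≈ 0#
        ψ-A {a} a∈α = begin
          ev F ψ (S a)                                                     ≈⟨ ev-ψ (S a) ⟩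
          δ * ev F β (S a) + (- βz * ev F (hyperplane y) (S a) + βy * ev F (hyperplane z) (S a))
            ≈⟨ +-cong (*-congˡ (βα≈0 a∈α)) (+-cong (*-congˡ (hyperplane-A y a∈α)) (*-congˡ (hyperplane-A z a∈α))) ⟩
          δ * 0# + (- βz * 0# + βy * 0#)
            ≈⟨ solve 3 (λ d b c → d :* con (ℤ.+ 0) :+ ((:- b) :* con (ℤ.+ 0) :+ c :* con (ℤ.+ 0)) := con (ℤ.+ 0)) refl δ βz βy ⟩
          0# ∎

      ratio : Row k → Carrier
      ratio β = ev F β (S y) * ev F β (S z) ⁻¹

      tangent-in-pencil : ∀ β → Tangent β → ∀ x → δ * ev F β x ≈ ev F β (S z) * ev F (pencil (ratio β)) x
      tangent-in-pencil β tβ x = begin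
        δ * ev F β x                                        ≈⟨ vanishing-on-A β (tangent-A β tβ) x ⟩
        βz * ev F (hyperplane y) x - βy * ev F (hyperplane z) x ≈⟨ +-congˡ (-‿cong (*-congʳ (sym βz*ratio≈βy))) ⟩
        βz * ev F (hyperplane y) x - βz * ratio β * ev F (hyperplane z) x
          ≈⟨ solve 4 (λ b u r v → b :* u :- b :* r :* v := b :* ((:- r) :* v :+ u)) refl βz _ (ratio β) _ ⟩
        βz * (- ratio β * ev F (hyperplane z) x + ev F (hyperplane y) x) ≈⟨ *-congˡ (ev-pencil (ratio β) x) ⟨
        βz * ev F (pencil (ratio β)) x                      ∎
        where
        βy = ev F β (S y)
        βz = ev F β (S z)
        βz*ratio≈βy : βz * ratio β ≈ βy
        βz*ratio≈βy = trans (*-comm βz (ratio β)) (x*y⁻¹*y≈x βy (tangent-≉0 β tβ z∉A))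

      tangent-kernel : ∀ β → Tangent β → SameKernel F β (pencil (ratio β))
      tangent-kernel β tβ x =
        (λ βx≈0 → x*y≈0⇒x≈0 (tangent-≉0 β tβ z∉A) (trans (*-comm _ _)
                   (trans (sym (tangent-in-pencil β tβ x)) (trans (*-congˡ βx≈0) (zeroʳ δ))))) ,
        (λ px≈0 → x*y≈0⇒x≈0 δ≉0 (trans (*-comm _ _)
                   (trans (tangent-in-pencil β tβ x) (trans (*-congˡ px≈0) (zeroʳ _)))))

      W : List (Fin s)
      W = elements (∁ ((A ∪ ⁅ y ⁆) ∪ ⁅ z ⁆))

      Secant : Fin s → Set
      Secant w = w ∉ A × w ≢ y × w ≢ z

      ∈W⇒Secant : ∀ {w} → w ∈ₗ W → Secant w
      ∈W⇒Secant {w} w∈W =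
        (λ w∈A → w∉ (x∈p∪q⁺ (inj₁ (x∈p∪q⁺ (inj₁ w∈A))))) ,
        (λ { ≡.refl → w∉ (x∈p∪q⁺ (inj₁ (x∈p∪q⁺ (inj₂ (x∈⁅x⁆ y))))) }) ,
        (λ { ≡.refl → w∉ (x∈p∪q⁺ (inj₂ (x∈⁅x⁆ z))) })
        where
        w∉ : w ∉ (A ∪ ⁅ y ⁆) ∪ ⁅ z ⁆
        w∉ = x∈∁p⇒x∉p (∈elements⇒∈ w∈W)

      Secant⇒∈W : ∀ {w} → Secant w → w ∈ₗ W
      Secant⇒∈W (w∉A , w≢y , w≢z) = ∈⇒∈elements (x∉p⇒x∈∁p (∉∪⁅⁆ (∉∪⁅⁆ w∉A w≢y) w≢z))

      secantRatio : Fin s → Carrier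
      secantRatio w = φ y w * φ z w ⁻¹

      φz-≉0 : ∀ {w} → Secant w → φ z w ≉ 0#
      φz-≉0 (w∉A , _ , w≢z) = φ-≉0 z∉A w∉A w≢z

      secant-root : ∀ {w} → Secant w → ev F (pencil (secantRatio w)) (S w) ≈ 0#
      secant-root {w} sw = begin
        ev F (pencil (secantRatio w)) (S w)              ≈⟨ ev-pencil (secantRatio w) (S w) ⟩
        - secantRatio w * ev F (hyperplane z) (S w) + ev F (hyperplane y) (S w)
          ≈⟨ +-cong (*-congˡ (sym (φ≈hyperplane z w))) (sym (φ≈hyperplane y w)) ⟩
        - secantRatio w * φ z w + φ y w                  ≈⟨ +-congʳ (-‿distribˡ-* _ _) ⟨
        - (secantRatio w * φ z w) + φ y w                ≈⟨ +-congʳ (-‿cong (x*y⁻¹*y≈x (φ y w) (φz-≉0 sw))) ⟩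
        - φ y w + φ y w                                  ≈⟨ -‿inverseˡ _ ⟩
        0#                                               ∎

      pencil-root⇒secantRatio : ∀ r {w} → Secant w → ev F (pencil r) (S w) ≈ 0# → r ≈ secantRatio w
      pencil-root⇒secantRatio r {w} sw pw≈0 = x*y≈z⇒x≈z*y⁻¹ (φz-≉0 sw) (begin
        r * φ z w          ≈⟨ -‿involutive _ ⟨
        - - (r * φ z w)    ≈⟨ -‿cong (inverseˡ-unique _ _ (begin
            - (r * φ z w) + φ y w  ≈⟨ +-cong (trans (-‿distribˡ-* r _) (*-congˡ (φ≈hyperplane z w))) (φ≈hyperplane y w) ⟩
            - r * ev F (hyperplane z) (S w) + ev F (hyperplane y) (S w) ≈⟨ ev-pencil r (S w) ⟨
            ev F (pencil r) (S w)  ≈⟨ pw≈0 ⟩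
            0#                     ∎)) ⟩
        - - φ y w          ≈⟨ -‿involutive _ ⟩
        φ y w              ∎)

      tangents-meet-A : All Tangent T
      tangents-meet-A = All.map proj₂ (proj₁ tangents)

      secants : All Secant W
      secants = All.tabulate ∈W⇒Secant

      ratios : List Carrier
      ratios = map ratio T ++ map secantRatio W

      ratios-≉0 : All (_≉ 0#) ratios
      ratios-≉0 = All.++⁺
        (All.map⁺ (All.map (λ {β} tβ → *-≉0 (tangent-≉0 β tβ y∉A) (⁻¹-≉0 (tangent-≉0 β tβ z∉A))) tangents-meet-A))
        (All.map⁺ (All.map (λ { sw@(w∉A , w≢y , _) → *-≉0 (φ-≉0 y∉A w∉A w≢y) (⁻¹-≉0 (φz-≉0 sw)) }) secants))

      ratios-unique : AllPairs _≉_ ratios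
      ratios-unique = AllPairs.++⁺
        (AllPairs.map⁺ (AllPairs-mapWith (λ {β} {γ} → tangent-ratios-distinct β γ) tangents-meet-A (proj₂ (proj₂ tangents))))
        (AllPairs.map⁺ (AllPairs-mapWith secant-ratios-distinct secants (elements-distinct (∁ ((A ∪ ⁅ y ⁆) ∪ ⁅ z ⁆)))))
        (All.map⁺ (All.map (λ {β} tβ → All.map⁺ (All.map (λ {w} sw → tangent≉secant β tβ sw) secants)) tangents-meet-A))
        where
        tangent-ratios-distinct : ∀ β γ → Tangent β → Tangent γ → ¬ SameKernel F β γ → ratio β ≉ ratio γ
        tangent-ratios-distinct β γ tβ tγ β≁γ ratios≈ = β≁γ λ x →
          (λ βx≈0 → proj₂ (tangent-kernel γ tγ x)
                      (trans (ev-pencil-cong (sym ratios≈) x) (proj₁ (tangent-kernel β tβ x) βx≈0))) ,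
          (λ γx≈0 → proj₂ (tangent-kernel β tβ x)
                      (trans (ev-pencil-cong ratios≈ x) (proj₁ (tangent-kernel γ tγ x) γx≈0)))
        -- a pencil member vanishing at two secant points and on A vanishes everywhere, yet not at z
        secant-ratios-distinct : ∀ {w w′} → Secant w → Secant w′ → w ≢ w′ → secantRatio w ≉ secantRatio w′
        secant-ratios-distinct {w} {w′} sw sw′ w≢w′ ratios≈ = δ≉0 (trans (sym (pencil-z (secantRatio w)))
          (arc-ev-vanishes (pencil (secantRatio w)) (w ∷ w′ ∷ α) (length-with w w′)
            (distinct-with (proj₁ sw) (proj₁ sw′) w≢w′)
            (secant-root sw ∷ trans (ev-pencil-cong ratios≈ (S w′)) (secant-root sw′) ∷ All.tabulate (pencil-A _)) (S z)))
        tangent≉secant : ∀ β → Tangent β → ∀ {w} → Secant w → ratio β ≉ secantRatio w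
        tangent≉secant β tβ {w} sw ratios≈ = tangent-≉0 β tβ (proj₁ sw)
          (proj₂ (tangent-kernel β tβ (S w)) (trans (ev-pencil-cong ratios≈ (S w)) (secant-root sw)))

      ratios-complete : ∀ r → r ≉ 0# → Any (r ≈_) ratios
      ratios-complete r r≉0 with any? (λ w → ev F (pencil r) (S w) ≟ 0#) W
      ... | yes root∈W = let w , w∈W , pw≈0 = find root∈W in
        Any.++⁺ʳ (map ratio T) (Any.map⁺ (lose w∈W (pencil-root⇒secantRatio r (∈W⇒Secant w∈W) pw≈0)))
      ... | no no-root∈W = let β , β∈T , p≡β = find (proj₁ (proj₂ tangents) (pencil r) (pencil-≢0 r) meets-A) in
        Any.++⁺ˡ (Any.map⁺ (lose β∈T (sameKernel⇒ratio β (All.lookup tangents-meet-A β∈T) p≡β)))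
        where
        meets-A : MeetsExactly F S A (pencil r)
        meets-A i = root⇒∈A , λ i∈A → pencil-A r (∈⇒∈elements i∈A)
          where
          root⇒∈A : ev F (pencil r) (S i) ≈ 0# → i ∈ A
          root⇒∈A pi≈0 with i ∈? A | i FinP.≟ y | i FinP.≟ z
          ... | yes i∈A | _        | _        = i∈A
          ... | no _    | yes ≡.refl | _      = ⊥-elim (*-≉0 r≉0 δ≉0 (trans (sym (pencil-y r)) pi≈0))
          ... | no _    | no _     | yes ≡.refl = ⊥-elim (δ≉0 (trans (sym (pencil-z r)) pi≈0))
          ... | no i∉A  | no i≢y   | no i≢z  = ⊥-elim (no-root∈W (lose (Secant⇒∈W (i∉A , i≢y , i≢z)) pi≈0))
        -- pencil r vanishes at - r · S z + S y, hence so does β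
        sameKernel⇒ratio : ∀ β → Tangent β → SameKernel F (pencil r) β → r ≈ ratio β
        sameKernel⇒ratio β tβ p≡β = x*y≈z⇒x≈z*y⁻¹ (tangent-≉0 β tβ z∉A) (begin
          r * βz           ≈⟨ -‿involutive _ ⟨
          - - (r * βz)     ≈⟨ -‿cong (inverseˡ-unique _ _ (begin
              - (r * βz) + βy                  ≈⟨ +-congʳ (-‿distribˡ-* r βz) ⟩
              - r * βz + βy                    ≈⟨ ev-linearʳ β (- r) (S z) (S y) ⟨
              ev F β (λ j → - r * S z j + S y j) ≈⟨ proj₁ (p≡β (λ j → - r * S z j + S y j)) u-root ⟩
              0#                               ∎)) ⟩
          - - βy           ≈⟨ -‿involutive _ ⟩
          βy               ∎)
          where
          βy = ev F β (S y)
          βz = ev F β (S z)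
          u-root : ev F (pencil r) (λ j → - r * S z j + S y j) ≈ 0#
          u-root = begin
            ev F (pencil r) (λ j → - r * S z j + S y j)          ≈⟨ ev-linearʳ (pencil r) (- r) (S z) (S y) ⟩
            - r * ev F (pencil r) (S z) + ev F (pencil r) (S y)  ≈⟨ +-cong (*-congˡ (pencil-z r)) (pencil-y r) ⟩
            - r * δ + r * δ                                      ≈⟨ solve 2 (λ r d → (:- r) :* d :+ r :* d := con (ℤ.+ 0)) refl r δ ⟩
            0#                                                   ∎

      prod-ratios : prod F ratios ≈ - 1#
      prod-ratios = wilson ratios ratios-unique ratios-≉0 ratios-complete

      tangent-ratio-product : prod F (map ratio T) * tangent F T (S z) ≈ tangent F T (S y)
      tangent-ratio-product = trans (sym (prod-map-* ratio (λ β → ev F β (S z)) T))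
        (prod-map-cong (All.map (λ {β} tβ → x*y⁻¹*y≈x (ev F β (S y)) (tangent-≉0 β tβ z∉A)) tangents-meet-A))

      secant-ratio-product : prod F (map secantRatio W) * prod F (map (φ z) W) ≈ prod F (map (φ y) W)
      secant-ratio-product = trans (sym (prod-map-* secantRatio (φ z) W))
        (prod-map-cong (All.map (λ {w} sw → x*y⁻¹*y≈x (φ y w) (φz-≉0 sw)) secants))

      K≈K : K y ≈ K z
      K≈K = begin
        f y * prod F (map (φ y) (elements (∁ (A ∪ ⁅ y ⁆))))
          ≈⟨ *-congˡ (prod-∁-insert (φ y) (A ∪ ⁅ y ⁆) (∉∪⁅⁆ z∉A (y≢z ∘ ≡.sym))) ⟩
        f y * (δ * P y)
          ≈⟨ solve 3 (λ f d p → f :* (d :* p) := d :* (f :* p)) refl (f y) δ (P y) ⟩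
        δ * (f y * P y)
          ≈⟨ *-congˡ (*-cong tangent-ratio-product secant-ratio-product) ⟨
        δ * ((ρ * f z) * (σ * P z))
          ≈⟨ solve 5 (λ d r f s p → d :* ((r :* f) :* (s :* p)) := (r :* s) :* (f :* (d :* p))) refl δ ρ (f z) σ (P z) ⟩
        (ρ * σ) * (f z * (δ * P z))
          ≈⟨ *-congʳ (trans (sym (prod-++ (map ratio T) (map secantRatio W))) prod-ratios) ⟩
        - 1# * (f z * (δ * P z))
          ≈⟨ solve 3 (λ f d p → (:- con (ℤ.+ 1)) :* (f :* (d :* p)) := f :* ((:- d) :* p)) refl (f z) δ (P z) ⟩
        f z * (- δ * P z)
          ≈⟨ *-congˡ (*-cong (sym φzy≈-δ) (reflexive (≡.cong (λ B → prod F (map (φ z) (elements (∁ B)))) y,z≡z,y))) ⟩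
        f z * (φ z y * prod F (map (φ z) (elements (∁ ((A ∪ ⁅ z ⁆) ∪ ⁅ y ⁆)))))
          ≈⟨ *-congˡ (prod-∁-insert (φ z) (A ∪ ⁅ z ⁆) (∉∪⁅⁆ y∉A y≢z)) ⟨
        f z * prod F (map (φ z) (elements (∁ (A ∪ ⁅ z ⁆)))) ∎
        where
        f = λ v → tangent F T (S v)
        P = λ v → prod F (map (φ v) W)
        ρ = prod F (map ratio T)
        σ = prod F (map secantRatio W)
        y,z≡z,y : (A ∪ ⁅ y ⁆) ∪ ⁅ z ⁆ ≡ (A ∪ ⁅ z ⁆) ∪ ⁅ y ⁆
        y,z≡z,y = ≡.trans (∪-assoc A ⁅ y ⁆ ⁅ z ⁆)
                    (≡.trans (≡.cong (A ∪_) (∪-comm ⁅ y ⁆ ⁅ z ⁆)) (≡.sym (∪-assoc A ⁅ z ⁆ ⁅ y ⁆)))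

    K-constant : ∀ {y z} → y ∉ A → z ∉ A → K y ≈ K z
    K-constant {y} {z} y∉A z∉A with y FinP.≟ z
    ... | yes ≡.refl = refl
    ... | no y≢z     = Pencil.K≈K y z y∉A z∉A y≢z

q+k+s-rearranged : ∀ q m N → (q ℕ.+ suc (suc m)) ℕ.+ (suc m ℕ.+ N) ≡ suc q ℕ.+ (N ℕ.+ (suc m ℕ.+ suc m))
q+k+s-rearranged = solve 3 (λ q m N → (q :+ (con 2 :+ m)) :+ ((con 1 :+ m) :+ N)
                                  := (con 1 :+ q) :+ (N :+ ((con 1 :+ m) :+ (con 1 :+ m)))) ≡.refl
  where open +-*-Solver

module SignPowers {c ℓ : Level} {q : ℕ} (F : FiniteField c ℓ q) where
  open FieldProperties F

  signPow≈-1^∣∣ : ∀ i → signPow F i ≈ -1^ ℤ.∣ i ∣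
  signPow≈-1^∣∣ i = parity ℤ.∣ i ∣
    where
    parity : ∀ n → (if does (n % 2 ℕ.≟ 0) then 1# else - 1#) ≈ -1^ n
    parity zero          = refl
    parity (suc zero)    = sym (*-identityʳ _)
    parity (suc (suc n)) = begin
      (if does (suc (suc n) % 2 ℕ.≟ 0) then 1# else - 1#) ≡⟨ ≡.cong (λ r → if does (r ℕ.≟ 0) then 1# else - 1#)
                                                              (≡.trans (≡.cong (_% 2) (ℕP.+-comm 2 n)) ([m+n]%n≡m%n n 2)) ⟩
      (if does (n % 2 ℕ.≟ 0) then 1# else - 1#)             ≈⟨ parity n ⟩
      -1^ n                                                 ≈⟨ solve 1 (λ a → a := (:- con (+ 1)) :* ((:- con (+ 1)) :* a)) refl (-1^ n) ⟩
      -1^ suc (suc n)                                       ∎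

  -1^∣⊖∣ : ∀ a b → -1^ ℤ.∣ a ⊖ b ∣ ≈ -1^ (a ℕ.+ b)
  -1^∣⊖∣ a b with ℕP.≤-total b a
  ... | inj₁ b≤a = begin
    -1^ ℤ.∣ a ⊖ b ∣                  ≡⟨ ≡.cong (λ i → -1^ ℤ.∣ i ∣) (ℤP.⊖-≥ b≤a) ⟩
    -1^ (a ∸ b)                      ≈⟨ trans (sym (*-identityʳ _)) (*-congˡ (sym (-1^-double b))) ⟩
    -1^ (a ∸ b) * -1^ (b ℕ.+ b)      ≈⟨ -1^-+ (a ∸ b) (b ℕ.+ b) ⟨
    -1^ ((a ∸ b) ℕ.+ (b ℕ.+ b))      ≡⟨ ≡.cong -1^_ (≡.trans (≡.sym (ℕP.+-assoc (a ∸ b) b b)) (≡.cong (ℕ._+ b) (ℕP.m∸n+n≡m b≤a))) ⟩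
    -1^ (a ℕ.+ b)                    ∎
  ... | inj₂ a≤b = begin
    -1^ ℤ.∣ a ⊖ b ∣                  ≡⟨ ≡.cong -1^_ (ℤP.∣⊖∣-≤ a≤b) ⟩
    -1^ (b ∸ a)                      ≈⟨ trans (sym (*-identityʳ _)) (*-congˡ (sym (-1^-double a))) ⟩
    -1^ (b ∸ a) * -1^ (a ℕ.+ a)      ≈⟨ -1^-+ (b ∸ a) (a ℕ.+ a) ⟨
    -1^ ((b ∸ a) ℕ.+ (a ℕ.+ a))      ≡⟨ ≡.cong -1^_ (≡.trans (≡.sym (ℕP.+-assoc (b ∸ a) a a))
                                          (≡.trans (≡.cong (ℕ._+ a) (ℕP.m∸n+n≡m a≤b)) (ℕP.+-comm b a))) ⟩
    -1^ (a ℕ.+ b)                    ∎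

  -1^-*-cong : ∀ t {x y} → -1^ x ≈ -1^ y → -1^ (t ℕ.* x) ≈ -1^ (t ℕ.* y)
  -1^-*-cong zero    _   = refl
  -1^-*-cong (suc t) {x} {y} e =
    trans (-1^-+ x (t ℕ.* x)) (trans (*-cong e (-1^-*-cong t e)) (sym (-1^-+ y (t ℕ.* y))))

  -1^-cancel : ∀ p t n → -1^ ((p ℕ.+ t) ℕ.* n) * -1^ (p ℕ.* n) ≈ -1^ (t ℕ.* n)
  -1^-cancel p t n = begin
    -1^ ((p ℕ.+ t) ℕ.* n) * -1^ (p ℕ.* n)        ≈⟨ *-congʳ (trans (reflexive (≡.cong -1^_ (ℕP.*-distribʳ-+ n p t)))
                                                                   (-1^-+ (p ℕ.* n) (t ℕ.* n))) ⟩
    (-1^ (p ℕ.* n) * -1^ (t ℕ.* n)) * -1^ (p ℕ.* n) ≈⟨ solve 2 (λ a b → (a :* b) :* a := (a :* a) :* b) refl _ _ ⟩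
    (-1^ (p ℕ.* n) * -1^ (p ℕ.* n)) * -1^ (t ℕ.* n) ≈⟨ trans (*-congʳ (-1^-square (p ℕ.* n))) (*-identityˡ _) ⟩
    -1^ (t ℕ.* n)                                   ∎

module DiagonalScaling {c ℓ : Level} {q : ℕ} (F : FiniteField c ℓ q) {s m : ℕ}
  (S : Fin s → Vector F (suc (suc m))) (arc : IsArc F S)
  (tang : Subset s → List (Vector F (suc (suc m))))
  (tangents : ∀ A → ∣ A ∣ ≡ m → IsTangentList F S A (tang A))
  (G : Subset s) where

  open FieldProperties F
  open Determinant commRing
  open ArcProperties F S arc
  open SignPowers F
  open SubsetElements
  open Matrices F S tang G
  open Wilson F using (-1^[1+q]≈1)

  private
    k : ℕ
    k = suc (suc m)

  N : ℕ
  N = s ∸ suc m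

  d₁ : Subset s → Carrier
  d₁ C = prod F (map (λ w → det k (map S (w ∷ elements C))) (elements (∁ C)))

  K : Subset s → Fin s → Carrier
  K A = LemmaOfTangents.K F S A (tang A)

  -- by the lemma of tangents, any point outside A would do
  K₀ : Subset s → Carrier
  K₀ A = Maybe.maybe (K A) 1# (first (∁ A))

  d₂ : Subset s → Subset s → Carrier
  d₂ _ A = -1^ (m ℕ.* N) * K₀ A ⁻¹

  s≡1+m+N : s ≡ suc m ℕ.+ N
  s≡1+m+N = ≡.sym (ℕP.m+[n∸m]≡n (ℕP.≤-trans (ℕP.n≤1+n _) (proj₁ arc)))

  d₁-≉0 : ∀ C → ∣ C ∣ ≡ suc m → d₁ C ≉ 0#
  d₁-≉0 C ∣C∣≡ = prod-≉0 (All.map⁺ (All.tabulate {xs = elements (∁ C)} λ w∈ →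
    let w∉C = x∈∁p⇒x∉p (∈elements⇒∈ {p = ∁ C} w∈) in
    arc-det-≉0 (_ ∷ elements C) (≡.cong suc (≡.trans (length-elements C) ∣C∣≡)) (∉⇒≢elements w∉C ∷ elements-distinct C)))

  module _ {A : Subset s} (∣A∣≡m : ∣ A ∣ ≡ m) where
    open LemmaOfTangents F S A (tang A) using (φ; K-constant; φ-≉0)

    tangent-≉0 : ∀ {y} → y ∉ A → tangent F (tang A) (S y) ≉ 0#
    tangent-≉0 {y} y∉A =
      prod-≉0 (All.map⁺ (All.map (λ (_ , meets) βy≈0 → y∉A (proj₁ (meets y) βy≈0)) (proj₁ (tangents A ∣A∣≡m))))

    K-≉0 : ∀ {y} → y ∉ A → K A y ≉ 0#
    K-≉0 {y} y∉A = *-≉0 (tangent-≉0 y∉A)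
      (prod-≉0 (All.map⁺ (All.tabulate {xs = elements (∁ (A ∪ ⁅ y ⁆))} λ {w} w∈ →
        let w∉A∪y = x∈∁p⇒x∉p (∈elements⇒∈ {p = ∁ (A ∪ ⁅ y ⁆)} w∈) in
        φ-≉0 arc ∣A∣≡m (tangents A ∣A∣≡m) y∉A (λ w∈A → w∉A∪y (x∈p∪q⁺ (inj₁ w∈A)))
          (λ { ≡.refl → w∉A∪y (x∈p∪q⁺ (inj₂ (x∈⁅x⁆ w))) }))))

    ∃∉A : ∃ λ i → i ∉ A
    ∃∉A = ∣p∣<n⇒∃∉ A (≡.subst (ℕ._< s) (≡.sym ∣A∣≡m) (ℕP.≤-trans (ℕP.n≤1+n _) (proj₁ arc)))

    K₀≈K : ∀ {y} → y ∉ A → K₀ A ≈ K A y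
    K₀≈K {y} y∉A with first-∈ (x∉p⇒x∈∁p (proj₂ ∃∉A))
    ... | y₀ , first≡ , y₀∈∁A = trans (reflexive (≡.cong (Maybe.maybe (K A) 1#) first≡))
                                      (K-constant arc ∣A∣≡m (tangents A ∣A∣≡m) (x∈∁p⇒x∉p y₀∈∁A) y∉A)

  -- t + 1 = (q + 1) - N, and q + 1 is even unless 1# + 1# ≈ 0#
  signPow-t+1 : ∀ τ → signPow F (+ τ ℤ.* t+1) ≈ -1^ (τ ℕ.* N)
  signPow-t+1 τ = begin
    signPow F (+ τ ℤ.* t+1)                  ≡⟨ ≡.cong (λ i → signPow F (+ τ ℤ.* i)) (ℤP.m-n≡m⊖n (q ℕ.+ k) s) ⟩
    signPow F (+ τ ℤ.* ((q ℕ.+ k) ⊖ s))      ≈⟨ signPow≈-1^∣∣ (+ τ ℤ.* ((q ℕ.+ k) ⊖ s)) ⟩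
    -1^ ℤ.∣ + τ ℤ.* ((q ℕ.+ k) ⊖ s) ∣        ≡⟨ ≡.cong -1^_ (ℤP.abs-* (+ τ) ((q ℕ.+ k) ⊖ s)) ⟩
    -1^ (τ ℕ.* ℤ.∣ (q ℕ.+ k) ⊖ s ∣)          ≈⟨ -1^-*-cong τ (trans (-1^∣⊖∣ (q ℕ.+ k) s) parity) ⟩
    -1^ (τ ℕ.* N)                            ∎
    where
    parity : -1^ ((q ℕ.+ k) ℕ.+ s) ≈ -1^ N
    parity = begin
      -1^ ((q ℕ.+ k) ℕ.+ s)                                ≡⟨ ≡.cong (λ x → -1^ ((q ℕ.+ k) ℕ.+ x)) s≡1+m+N ⟩
      -1^ ((q ℕ.+ k) ℕ.+ (suc m ℕ.+ N))                    ≡⟨ ≡.cong -1^_ (q+k+s-rearranged q m N) ⟩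
      -1^ (suc q ℕ.+ (N ℕ.+ (suc m ℕ.+ suc m)))            ≈⟨ trans (-1^-+ (suc q) _) (*-cong -1^[1+q]≈1 (-1^-+ N _)) ⟩
      1# * (-1^ N * -1^ (suc m ℕ.+ suc m))                 ≈⟨ trans (*-identityˡ _) (trans (*-congˡ (-1^-double (suc m))) (*-identityʳ _)) ⟩
      -1^ N                                                ∎

  module _ {A : Subset s} (∣A∣≡m : ∣ A ∣ ≡ m) {y : Fin s} (y∉A : y ∉ A) (∣A∪y∣≡ : ∣ A ∪ ⁅ y ⁆ ∣ ≡ suc m) where
    open LemmaOfTangents F S A (tang A) using (φ)

    -- moving S y past the p elements of A before it
    K-via-d₁ : ∃ λ p → p ℕ.+ τ A y ≡ m × K A y ≈ tangent F (tang A) (S y) * (-1^ (p ℕ.* N) * d₁ (A ∪ ⁅ y ⁆))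
    K-via-d₁ with elements-insert A y y∉A
    ... | L₁ , L₂ , A∪y≡ , A≡ , ∣L₂∣≡τ = length L₁ , p+τ≡m , *-congˡ (begin
      prod F (map (φ y) others)                                       ≈⟨ prod-map-cong (All.tabulate {xs = others} (λ {w} _ → move w)) ⟩
      prod F (map (λ w → -1^ length L₁ * row w) others)               ≈⟨ prod-map-* (λ _ → -1^ length L₁) row others ⟩
      prod F (map (λ _ → -1^ length L₁) others) * d₁ (A ∪ ⁅ y ⁆)      ≈⟨ *-congʳ (prod-map-const _ others) ⟩
      (-1^ length L₁) ^ length others * d₁ (A ∪ ⁅ y ⁆)                ≈⟨ *-congʳ (^-assocʳ (- 1#) (length L₁) (length others)) ⟩
      -1^ (length L₁ ℕ.* length others) * d₁ (A ∪ ⁅ y ⁆)              ≡⟨ ≡.cong (λ n → -1^ (length L₁ ℕ.* n) * d₁ (A ∪ ⁅ y ⁆)) ∣others∣≡N ⟩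
      -1^ (length L₁ ℕ.* N) * d₁ (A ∪ ⁅ y ⁆)                           ∎)
      where
      others = elements (∁ (A ∪ ⁅ y ⁆))
      row = λ w → det k (map S (w ∷ elements (A ∪ ⁅ y ⁆)))
      ∣others∣≡N : length others ≡ N
      ∣others∣≡N = ≡.trans (length-elements (∁ (A ∪ ⁅ y ⁆))) (≡.trans (∣∁p∣≡n∸∣p∣ (A ∪ ⁅ y ⁆)) (≡.cong (s ∸_) ∣A∪y∣≡))
      p+τ≡m : length L₁ ℕ.+ τ A y ≡ m
      p+τ≡m = ≡.trans (≡.cong (length L₁ ℕ.+_) (≡.sym ∣L₂∣≡τ))
                (≡.trans (≡.sym (List.length-++ L₁)) (≡.trans (≡.cong length (≡.sym A≡)) (≡.trans (length-elements A) ∣A∣≡m)))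
      move : ∀ w → φ y w ≈ -1^ length L₁ * row w
      move w = begin
        det k (S w ∷ S y ∷ map S (elements A))                        ≡⟨ ≡.cong (λ l → det k (S w ∷ S y ∷ l))
                                                                            (≡.trans (≡.cong (map S) A≡) (List.map-++ S L₁ L₂)) ⟩
        det k ((S w ∷ []) ++ S y ∷ map S L₁ ++ map S L₂)              ≈⟨ det-move k (S w ∷ []) (S y) (map S L₁) (map S L₂) ⟩
        -1^ length (map S L₁) * det k (S w ∷ map S L₁ ++ S y ∷ map S L₂) ≡⟨ ≡.cong₂ (λ n l → -1^ n * det k (S w ∷ l))
                                                                            (List.length-map S L₁)
                                                                            (≡.sym (≡.trans (≡.cong (map S) A∪y≡) (List.map-++ S L₁ (y ∷ L₂)))) ⟩
        -1^ length L₁ * row w                                         ∎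

    entry : ∀ U → (d₁ (A ∪ ⁅ y ⁆) * tangent F (tang A) (S y)) * d₂ U A ≈ signPow F (+ τ A y ℤ.* t+1)
    entry U with K-via-d₁
    ... | p , p+τ≡m , K≈ = begin
      u * (-1^ (m ℕ.* N) * K₀ A ⁻¹)            ≈⟨ *-congˡ (*-congˡ K₀⁻¹≈u⁻¹*g) ⟩
      u * (-1^ (m ℕ.* N) * (u ⁻¹ * g))         ≈⟨ solve 4 (λ u s i g → u :* (s :* (i :* g)) := (u :* i) :* (s :* g))
                                                     refl u (-1^ (m ℕ.* N)) (u ⁻¹) g ⟩
      (u * u ⁻¹) * (-1^ (m ℕ.* N) * g)         ≈⟨ trans (*-congʳ (*-inverseʳ u≉0)) (*-identityˡ _) ⟩
      -1^ (m ℕ.* N) * -1^ (p ℕ.* N)            ≡⟨ ≡.cong (λ x → -1^ (x ℕ.* N) * g) (≡.sym p+τ≡m) ⟩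
      -1^ ((p ℕ.+ τ A y) ℕ.* N) * -1^ (p ℕ.* N) ≈⟨ -1^-cancel p (τ A y) N ⟩
      -1^ (τ A y ℕ.* N)                        ≈⟨ signPow-t+1 (τ A y) ⟨
      signPow F (+ τ A y ℤ.* t+1)              ∎
      where
      u = d₁ (A ∪ ⁅ y ⁆) * tangent F (tang A) (S y)
      g = -1^ (p ℕ.* N)
      u≉0 : u ≉ 0#
      u≉0 = *-≉0 (d₁-≉0 (A ∪ ⁅ y ⁆) ∣A∪y∣≡) (tangent-≉0 ∣A∣≡m y∉A)
      K₀≈u*g : K₀ A ≈ u * g
      K₀≈u*g = trans (K₀≈K ∣A∣≡m y∉A) (trans K≈
        (solve 3 (λ f g d → f :* (g :* d) := (d :* f) :* g) refl (tangent F (tang A) (S y)) g (d₁ (A ∪ ⁅ y ⁆))))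
      K₀⁻¹≈u⁻¹*g : K₀ A ⁻¹ ≈ u ⁻¹ * g
      K₀⁻¹≈u⁻¹*g = trans (⁻¹-cong K₀≈u*g) (⁻¹-unique (begin
        (u * g) * (u ⁻¹ * g)   ≈⟨ *-interchange u g (u ⁻¹) g ⟩
        (u * u ⁻¹) * (g * g)   ≈⟨ *-cong (*-inverseʳ u≉0) (-1^-square (p ℕ.* N)) ⟩
        1# * 1#                ≈⟨ *-identityˡ 1# ⟩
        1#                     ∎))

  scaled-entry : ∀ C U A → ∣ C ∣ ≡ suc m → ∣ A ∣ ≡ m → (d₁ C * Q C U A) * d₂ U A ≈ I C U A
  scaled-entry C U A ∣C∣≡ ∣A∣≡m with A ⊆? C
  ... | no _ = trans (*-congʳ (zeroʳ _)) (zeroˡ _)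
  ... | yes A⊆C with does (C ⊆? (G ─ U))
  ...   | false = trans (*-congʳ (zeroʳ _)) (zeroˡ _)
  ...   | true with ⊆∧∣∣≡suc⇒insert A C A⊆C (≡.trans ∣C∣≡ (≡.cong suc (≡.sym ∣A∣≡m)))
  ...     | y , first≡ , ≡.refl , y∉A = begin
    (d₁ (A ∪ ⁅ y ⁆) * Maybe.maybe (λ x → tangent F (tang A) (S x)) 0# (first ((A ∪ ⁅ y ⁆) ─ A))) * d₂ U A
      ≡⟨ ≡.cong (λ r → (d₁ (A ∪ ⁅ y ⁆) * Maybe.maybe (λ x → tangent F (tang A) (S x)) 0# r) * d₂ U A) first≡ ⟩
    (d₁ (A ∪ ⁅ y ⁆) * tangent F (tang A) (S y)) * d₂ U A
      ≈⟨ entry ∣A∣≡m y∉A ∣C∣≡ U ⟩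
    signPow F (+ τ A y ℤ.* t+1)
      ≡⟨ ≡.cong (Maybe.maybe (λ x → signPow F (+ τ A x ℤ.* t+1)) 0#) first≡ ⟨
    Maybe.maybe (λ x → signPow F (+ τ A x ℤ.* t+1)) 0# (first ((A ∪ ⁅ y ⁆) ─ A)) ∎

  d₂-≉0 : ∀ U A → ∣ A ∣ ≡ m → d₂ U A ≉ 0#
  d₂-≉0 U A ∣A∣≡m = *-≉0 (-1^-≉0 (m ℕ.* N)) (⁻¹-≉0 λ K₀≈0 →
    K-≉0 {A} ∣A∣≡m y∉A (trans (sym (K₀≈K {A} ∣A∣≡m y∉A)) K₀≈0))
    where
    y∉A = proj₂ (∃∉A {A} ∣A∣≡m)

lemma5p4 : ∀ {c ℓ : Level} {q : ℕ} (F : FiniteField c ℓ q) {k s : ℕ}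
    (S : Fin s → Vector F k) → 2 ≤ k → IsArc F S →
    (tang : Subset s → List (Vector F k)) →
    (∀ A → ∣ A ∣ ≡ k ∸ 2 → IsTangentList F S A (tang A)) →
    (G : Subset s) (n : ℕ) → n ℕ.+ k ≤ ∣ G ∣ ℕ.+ 1 →
    let open FiniteField F
        open Matrices F S tang G
    in ∃ λ (d₁ : Subset s → Carrier) → ∃ λ (d₂ : Subset s → Subset s → Carrier) →
         (∀ C → C ⊆ G → ∣ C ∣ ≡ k ∸ 1 → ∃ λ e → d₁ C * e ≈ 1#)
         × (∀ U A → U ⊆ G → ∣ U ∣ ≡ n → A ⊆ G ─ U → ∣ A ∣ ≡ k ∸ 2 →
              ∃ λ e → d₂ U A * e ≈ 1#)
         × (∀ C U A → C ⊆ G → ∣ C ∣ ≡ k ∸ 1 →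
              U ⊆ G → ∣ U ∣ ≡ n → A ⊆ G ─ U → ∣ A ∣ ≡ k ∸ 2 →
              (d₁ C * Q C U A) * d₂ U A ≈ I C U A)
-- The scaling works entrywise.
lemma5p4 F S (s≤s (s≤s z≤n)) arc tang tangents G n _ =
  d₁ , d₂ ,
  (λ C _ ∣C∣≡ → d₁ C ⁻¹ , *-inverseʳ (d₁-≉0 C ∣C∣≡)) ,
  (λ U A _ _ _ ∣A∣≡ → d₂ U A ⁻¹ , *-inverseʳ (d₂-≉0 U A ∣A∣≡)) ,
  (λ C U A _ ∣C∣≡ _ _ _ ∣A∣≡ → scaled-entry C U A ∣C∣≡ ∣A∣≡)
  where
  open FieldProperties F
  open DiagonalScaling F S arc tang tangents G
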